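{- For every $n\ge0$, $\#\mathrm{Av}_n([1234],[1423])=\#\mathrm{Av}_n([1324],[1432])$. Moreover, for $n\ge1$, $\#\mathrm{Av}_n([1234],[1423])=1+\binom{n-1}{2}$.
   Context: For a linear permutation $\pi=\pi_1\ldots\pi_n$ of $[n]$, the cyclic permutation $[\pi]$ is the set of all rotations of $\pi$. A linear permutation $\sigma$ contains $\pi$ if some subsequence of $\sigma$ is order isomorphic to $\pi$ (same relative order). A cyclic permutation $[\sigma]$ contains $[\pi]$ if some rotation of $\sigma$ contains $\pi$; otherwise it avoids $[\pi]$. For a set of cyclic patterns $[\Pi]$, $\mathrm{Av}_n[\Pi]$ denotes the set of cyclic permutations of length $n$ avoiding every pattern in $[\Pi]$. -}

module Defs where

-- Conventions: a linear permutation of [n] is represented as a list of the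
-- natural numbers 0 .. n-1 (each exactly once); order isomorphism only
-- depends on relative order, so the shift from {1..n} to {0..n-1} is immaterial.

open import Data.Nat using (ℕ; zero; suc; _<ᵇ_; _≡ᵇ_)
open import Data.Bool using (Bool; true; false; _∧_; not; if_then_else_)
open import Data.List using (List; []; _∷_; map; _++_; concatMap; drop; take; length; upTo)
open import Data.Bool.ListAction using (any; all)

inserts : ℕ → List ℕ → List (List ℕ)
inserts x [] = (x ∷ []) ∷ []
inserts x (y ∷ ys) = (x ∷ y ∷ ys) ∷ map (y ∷_) (inserts x ys)

perms : ℕ → List (List ℕ)
perms zero = [] ∷ []
perms (suc n) = concatMap (inserts n) (perms n)

-- all subsequences of a list (with multiplicity; only used under "any")
subseqs : List ℕ → List (List ℕ)
subseqs [] = [] ∷ []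
subseqs (x ∷ xs) = map (x ∷_) (subseqs xs) ++ subseqs xs

_⇔ᵇ_ : Bool → Bool → Bool
true ⇔ᵇ b = b
false ⇔ᵇ b = not b

sameOrder : ℕ → ℕ → ℕ → ℕ → Bool
sameOrder a a' b b' = ((a <ᵇ a') ⇔ᵇ (b <ᵇ b')) ∧ ((a' <ᵇ a) ⇔ᵇ (b' <ᵇ b))

headOK : ℕ → List ℕ → ℕ → List ℕ → Bool
headOK a [] b [] = true
headOK a (a' ∷ as) b (b' ∷ bs) = sameOrder a a' b b' ∧ headOK a as b bs
headOK a _ b _ = false

orderIso : List ℕ → List ℕ → Bool
orderIso [] [] = true
orderIso (a ∷ as) (b ∷ bs) = headOK a as b bs ∧ orderIso as bs
orderIso _ _ = false

contains : List ℕ → List ℕ → Bool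
contains σ π = any (orderIso π) (subseqs σ)

rotate : ℕ → List ℕ → List ℕ
rotate i σ = drop i σ ++ take i σ

-- all rotations of σ (rotation by length σ, = σ, is included so that
-- the empty word has itself as a rotation)
rotations : List ℕ → List (List ℕ)
rotations σ = map (λ i → rotate i σ) (upTo (suc (length σ)))

cycContains : List ℕ → List ℕ → Bool
cycContains σ π = any (λ τ → contains τ π) (rotations σ)

cycAvoidsAll : List (List ℕ) → List ℕ → Bool
cycAvoidsAll Π σ = all (λ π → not (cycContains σ π)) Π

eqList : List ℕ → List ℕ → Bool
eqList [] [] = true
eqList (x ∷ xs) (y ∷ ys) = (x ≡ᵇ y) ∧ eqList xs ys
eqList _ _ = false

sameCyclic : List ℕ → List ℕ → Bool
sameCyclic σ τ = any (eqList τ) (rotations σ)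

countClasses : List (List ℕ) → ℕ
countClasses [] = zero
countClasses (σ ∷ σs) = if any (sameCyclic σ) σs then countClasses σs else suc (countClasses σs)

filterᵇ : (List ℕ → Bool) → List (List ℕ) → List (List ℕ)
filterᵇ p [] = []
filterᵇ p (x ∷ xs) = if p x then x ∷ filterᵇ p xs else filterᵇ p xs

numAv : ℕ → List (List ℕ) → ℕ
numAv n Π = countClasses (filterᵇ (cycAvoidsAll Π) (perms n))

{-# OPTIONS --safe #-}
module Submission where

-- Every cyclic class of length m + 1 has exactly one representative m ∷ τ that starts with its
-- maximum m, so #Av_{m+1}[Π] counts the τ ∈ S_m for which [m ∷ τ] avoids Π.  In a cyclic
-- occurrence the entry m can only play the largest letter, hence [m ∷ τ] avoids [1234], [1423]
-- iff τ avoids 123 and 231, and avoids [1324], [1432] iff τ avoids 132 and 321.  These are the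
-- reverses of 231 and 123, and reversal permutes S_m: this gives the equality.
-- To count Av_m(123, 231), insert the maximum m after the first k entries of τ ∈ Av_m(123, 231):
-- the result avoids both patterns iff these k entries decrease and lie below all later ones.
-- For k = 0 this always holds, and for each 1 ≤ k ≤ m exactly one τ qualifies, so
-- #Av_{m+1}(123, 231) = #Av_m(123, 231) + m, which gives 1 + C(m, 2).

open import Defs
open import Data.Bool using (Bool; true; false; T; T?; not; _∧_; _∨_; if_then_else_)
open import Data.Bool.ListAction using (and; or; any; all)
open import Data.Bool.Properties using (T-∧; T-≡; ⇔→≡; ∧-identityʳ; ∧-assoc; ∧-idem)
open import Data.Empty using (⊥; ⊥-elim)
open import Data.Nat
  using (ℕ; zero; suc; _+_; _∸_; _<_; _≤_; _≤?_; z≤n; s≤s; s≤s⁻¹; _<ᵇ_; _≡ᵇ_; _≟_)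
open import Data.Nat.Combinatorics using (_C_; nC1≡n; nCk+nC[k+1]≡[n+1]C[k+1])
open import Data.Nat.Properties
  using (<ᵇ⇒<; <⇒<ᵇ; ≡ᵇ⇒≡; ≡⇒≡ᵇ; n<1+n; <-irrefl; <-asym; <-trans; <⇒≤; <⇒≢; <⇒≱; ≮⇒≥; ≰⇒>;
         ≤∧≢⇒<; ≤-refl; ≤-trans; ≤-antisym; <-cmp; +-assoc; +-comm; +-identityʳ; suc-injective;
         +-commutativeSemigroup)
open import Algebra.Properties.CommutativeSemigroup +-commutativeSemigroup using (interchange)
open import Data.List using (List; []; _∷_; _++_; map; concatMap; take; drop; length; reverse; upTo; filter)
open import Data.List.Properties
  using (++-assoc; ++-identityʳ; ∷-injective; ∷-injectiveˡ; ∷-injectiveʳ; take++drop≡id; take-all; drop-all;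
         length-++-≤ˡ; length-map; length-upTo; upTo-∷ʳ; map-cong; filter-++; filter-all; filter-reject;
         reverse-injective; reverse-involutive)
open import Data.List.Membership.Propositional using (_∈_; find; lose)
open import Data.List.Membership.Propositional.Properties
  using (∈-map⁺; ∈-map⁻; ∈-++⁺ˡ; ∈-++⁺ʳ; ∈-++⁻; ∈-upTo⁺; ∈-upTo⁻; ∈-concatMap⁺; ∈-concatMap⁻;
         ∈-∃++; ∈-filter⁺; ∈-filter⁻)
open import Data.List.Membership.Propositional.Properties.WithK using (unique∧set⇒bag)
open import Data.List.Relation.Binary.BagAndSetEquality using (∼bag⇒↭)
open import Data.List.Relation.Binary.Disjoint.Propositional using (Disjoint)
open import Data.List.Relation.Binary.Permutation.Propositional as ↭
  using (_↭_; ↭-refl; ↭-reflexive; ↭-sym; ↭-trans; ↭-prep; ↭⇒↭ₛ; module PermutationReasoning)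
open import Data.List.Relation.Binary.Permutation.Propositional.Properties
  using (shift; ∷↭∷ʳ; drop-mid; ↭-empty-inv; Any-resp-↭; All-resp-↭; ↭-length; ++-comm; ↭-reverse;
         filter-↭)
import Data.List.Relation.Binary.Permutation.Setoid.Properties as Permutationₛ
open import Data.List.Relation.Binary.Pointwise using (Pointwise; []; _∷_)
open import Data.List.Relation.Binary.Sublist.Propositional
  using (_⊆_; []; _∷_; _∷ʳ_; ⊆-refl; ⊆-trans; to∈; from∈)
open import Data.List.Relation.Binary.Sublist.Propositional.Properties
  using (++⁺; ∷⁻; ∷ʳ⁻; ∷ˡ⁻; All-resp-⊆; []⊆-universal; reverse⁺; reverse⁻)
open import Data.List.Relation.Unary.All as All using (All; []; _∷_)
import Data.List.Relation.Unary.All.Properties as All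
open import Data.List.Relation.Unary.AllPairs using (AllPairs; []; _∷_)
import Data.List.Relation.Unary.AllPairs.Properties as AllPairs
open import Data.List.Relation.Unary.Any as Any using (Any; here; there)
import Data.List.Relation.Unary.Any.Properties as Any
open import Data.List.Relation.Unary.Unique.Propositional using (Unique)
import Data.List.Relation.Unary.Unique.Propositional.Properties as Unique
open import Data.Product using (∃; ∃₂; ∃-syntax; _×_; _,_; proj₁; proj₂)
open import Data.Sum using (_⊎_; inj₁; inj₂; [_,_]) renaming (map to ⊎-map; swap to ⊎-swap)
open import Data.Sum.Function.Propositional using (_⊎-⇔_)
open import Function using (_∘_; Equivalence; _⇔_; mk⇔)
import Function.Properties.Equivalence as ⇔
open import Relation.Binary.Definitions using (tri<; tri≈; tri>)
open import Relation.Binary.PropositionalEquality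
  using (_≡_; _≢_; refl; sym; trans; cong; cong₂; subst; setoid; module ≡-Reasoning)
open import Relation.Nullary using (¬_; Dec; ¬?; yes; no; contradiction)

private
  variable
    A B : Set
    a b k m p x y M : ℕ
    l s r t t₁ t₂ σ σ′ τ τ′ ρ π : List A
    xs ys L : List A

-- Rotations and sublists

Rotation : List A → List A → Set
Rotation σ τ = ∃₂ λ u v → σ ≡ u ++ v × τ ≡ v ++ u

Rotation-sym : Rotation σ τ → Rotation τ σ
Rotation-sym (u , v , σ≡uv , τ≡vu) = v , u , τ≡vu , σ≡uv

++-≡-++ : ∀ (a b c d : List A) → a ++ b ≡ c ++ d →
          (∃ λ w → c ≡ a ++ w × b ≡ w ++ d) ⊎ (∃ λ w → a ≡ c ++ w × d ≡ w ++ b)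
++-≡-++ []      b c       d eq = inj₁ (c , refl , eq)
++-≡-++ (x ∷ a) b []      d eq = inj₂ (x ∷ a , refl , sym eq)
++-≡-++ (x ∷ a) b (y ∷ c) d eq with ∷-injective eq
... | refl , eq′ with ++-≡-++ a b c d eq′
...   | inj₁ (w , refl , b≡wd) = inj₁ (w , refl , b≡wd)
...   | inj₂ (w , refl , d≡wb) = inj₂ (w , refl , d≡wb)

Rotation-trans : Rotation σ τ → Rotation τ ρ → Rotation σ ρ
Rotation-trans (u , v , refl , τ≡vu) (u′ , v′ , τ≡u′v′ , refl)
  with ++-≡-++ v u u′ v′ (trans (sym τ≡vu) τ≡u′v′)
... | inj₁ (w , refl , refl) = w , v′ ++ v , ++-assoc w v′ v , sym (++-assoc v′ v w)
... | inj₂ (w , refl , refl) = u ++ u′ , w , sym (++-assoc u u′ w) , ++-assoc w u u′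

Rotation⇒↭ : Rotation σ τ → σ ↭ τ
Rotation⇒↭ (u , v , refl , refl) = ++-comm u v

Rotation-∷₄ : ∀ {a b c d : A} → Rotation (a ∷ b ∷ c ∷ d ∷ []) r →
              r ≡ a ∷ b ∷ c ∷ d ∷ [] ⊎ r ≡ b ∷ c ∷ d ∷ a ∷ [] ⊎
              r ≡ c ∷ d ∷ a ∷ b ∷ [] ⊎ r ≡ d ∷ a ∷ b ∷ c ∷ []
Rotation-∷₄ ([]                    , _  , refl , refl) = inj₁ refl
Rotation-∷₄ (_ ∷ []                , _  , refl , refl) = inj₂ (inj₁ refl)
Rotation-∷₄ (_ ∷ _ ∷ []            , _  , refl , refl) = inj₂ (inj₂ (inj₁ refl))
Rotation-∷₄ (_ ∷ _ ∷ _ ∷ []        , _  , refl , refl) = inj₂ (inj₂ (inj₂ refl))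
Rotation-∷₄ (_ ∷ _ ∷ _ ∷ _ ∷ []    , [] , refl , refl) = inj₁ refl
Rotation-∷₄ (_ ∷ _ ∷ _ ∷ _ ∷ _ ∷ _ , _  , ()   , _)

⊆-++-split : ∀ u v → s ⊆ u ++ v → ∃₂ λ s₁ s₂ → s ≡ s₁ ++ s₂ × s₁ ⊆ u × s₂ ⊆ v
⊆-++-split []      v p = [] , _ , refl , [] , p
⊆-++-split (x ∷ u) v (.x ∷ʳ p) with ⊆-++-split u v p
... | s₁ , s₂ , refl , p₁ , p₂ = s₁ , s₂ , refl , x ∷ʳ p₁ , p₂
⊆-++-split (x ∷ u) v (refl ∷ p) with ⊆-++-split u v p
... | s₁ , s₂ , refl , p₁ , p₂ = x ∷ s₁ , s₂ , refl , refl ∷ p₁ , p₂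

++-⊆-split : ∀ s₁ s₂ → s₁ ++ s₂ ⊆ σ → ∃₂ λ σ₁ σ₂ → σ ≡ σ₁ ++ σ₂ × s₁ ⊆ σ₁ × s₂ ⊆ σ₂
++-⊆-split []       s₂ p = [] , _ , refl , [] , p
++-⊆-split (x ∷ s₁) s₂ (y ∷ʳ p) with ++-⊆-split (x ∷ s₁) s₂ p
... | σ₁ , σ₂ , refl , p₁ , p₂ = y ∷ σ₁ , σ₂ , refl , y ∷ʳ p₁ , p₂
++-⊆-split (x ∷ s₁) s₂ (refl ∷ p) with ++-⊆-split s₁ s₂ p
... | σ₁ , σ₂ , refl , p₁ , p₂ = x ∷ σ₁ , σ₂ , refl , refl ∷ p₁ , p₂

⊆-Rotation : Rotation σ ρ → s ⊆ ρ → ∃ λ r → Rotation s r × r ⊆ σ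
⊆-Rotation (u , v , refl , refl) s⊆vu with ⊆-++-split v u s⊆vu
... | s₁ , s₂ , refl , s₁⊆v , s₂⊆u = s₂ ++ s₁ , (s₁ , s₂ , refl , refl) , ++⁺ s₂⊆u s₁⊆v

Rotation-⊆ : Rotation s r → r ⊆ σ → ∃ λ ρ → Rotation σ ρ × s ⊆ ρ
Rotation-⊆ (u , v , refl , refl) vu⊆σ with ++-⊆-split v u vu⊆σ
... | σ₁ , σ₂ , refl , v⊆σ₁ , u⊆σ₂ = σ₂ ++ σ₁ , (σ₁ , σ₂ , refl , refl) , ++⁺ u⊆σ₂ v⊆σ₁

T⇔T⇒≡ : ∀ {a b} → T a ⇔ T b → a ≡ b
T⇔T⇒≡ a⇔b = ⇔→≡ (⇔.trans (⇔.sym T-≡) (⇔.trans a⇔b T-≡))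

T-not : ∀ {b} → T (not b) ⇔ (¬ T b)
T-not {true}  = mk⇔ (λ ()) (λ ¬t → ¬t _)
T-not {false} = mk⇔ (λ _ ()) (λ _ → _)

¬T⇒≡false : ∀ {b} → ¬ T b → b ≡ false
¬T⇒≡false {false} _  = refl
¬T⇒≡false {true}  ¬t = ⊥-elim (¬t _)

T-∧⁻ : ∀ a {b} → T (a ∧ b) → T a × T b
T-∧⁻ a = Equivalence.to (T-∧ {a})

all-not≡not-any : ∀ (f : A → Bool) xs → all (not ∘ f) xs ≡ not (any f xs)
all-not≡not-any f []       = refl
all-not≡not-any f (x ∷ xs) with f x
... | true  = refl
... | false = all-not≡not-any f xs

T-any-pair : ∀ (f : A → Bool) a₁ a₂ → T (any f (a₁ ∷ a₂ ∷ [])) ⇔ (T (f a₁) ⊎ T (f a₂))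
T-any-pair f a₁ a₂ = ⇔.trans (⇔.sym (Any.any⇔ {xs = a₁ ∷ a₂ ∷ []} {p = f}))
  (mk⇔ (λ { (here t) → inj₁ t ; (there (here t)) → inj₂ t ; (there (there ())) }) [ here , there ∘ here ])

all-not-pair-cong : ∀ (f : A → Bool) (g : B → Bool) a₁ a₂ b₁ b₂ →
                    (T (f a₁) ⊎ T (f a₂)) ⇔ (T (g b₁) ⊎ T (g b₂)) →
                    all (not ∘ f) (a₁ ∷ a₂ ∷ []) ≡ all (not ∘ g) (b₁ ∷ b₂ ∷ [])
all-not-pair-cong f g a₁ a₂ b₁ b₂ f⇔g = begin
  all (not ∘ f) (a₁ ∷ a₂ ∷ []) ≡⟨ all-not≡not-any f (a₁ ∷ a₂ ∷ []) ⟩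
  not (any f (a₁ ∷ a₂ ∷ []))   ≡⟨ cong not (T⇔T⇒≡ (⇔.trans (T-any-pair f a₁ a₂)
                                                   (⇔.trans f⇔g (⇔.sym (T-any-pair g b₁ b₂))))) ⟩
  not (any g (b₁ ∷ b₂ ∷ []))   ≡⟨ all-not≡not-any g (b₁ ∷ b₂ ∷ []) ⟨
  all (not ∘ g) (b₁ ∷ b₂ ∷ []) ∎
  where open ≡-Reasoning

any-cong : ∀ {f g : A → Bool} → (∀ x → f x ≡ g x) → ∀ xs → any f xs ≡ any g xs
any-cong f≗g xs = cong or (map-cong f≗g xs)

any-↭ : ∀ (f : A → Bool) {xs ys} → xs ↭ ys → any f xs ≡ any f ys
any-↭ f p = T⇔T⇒≡ (mk⇔ (Any.any⁺ f ∘ Any-resp-↭ p ∘ Any.any⁻ f _)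
                       (Any.any⁺ f ∘ Any-resp-↭ (↭-sym p) ∘ Any.any⁻ f _))

∈-subseqs⁻ : ∀ σ → s ∈ subseqs σ → s ⊆ σ
∈-subseqs⁻ []      (here refl) = []
∈-subseqs⁻ (x ∷ σ) s∈ with ∈-++⁻ (map (x ∷_) (subseqs σ)) s∈
... | inj₂ s∈rest = x ∷ʳ ∈-subseqs⁻ σ s∈rest
... | inj₁ s∈map with ∈-map⁻ (x ∷_) s∈map
...   | s′ , s′∈ , refl = refl ∷ ∈-subseqs⁻ σ s′∈

∈-subseqs⁺ : s ⊆ σ → s ∈ subseqs σ
∈-subseqs⁺ []                   = here refl
∈-subseqs⁺ {σ = x ∷ σ} (_ ∷ʳ p) = ∈-++⁺ʳ (map (x ∷_) (subseqs σ)) (∈-subseqs⁺ p)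
∈-subseqs⁺ (refl ∷ p)           = ∈-++⁺ˡ (∈-map⁺ (_ ∷_) (∈-subseqs⁺ p))

drop-length-++ : ∀ (u v : List A) → drop (length u) (u ++ v) ≡ v
drop-length-++ []      v = refl
drop-length-++ (x ∷ u) v = drop-length-++ u v

take-length-++ : ∀ (u v : List A) → take (length u) (u ++ v) ≡ u
take-length-++ []      v = refl
take-length-++ (x ∷ u) v = cong (x ∷_) (take-length-++ u v)

∈-rotations⁻ : ρ ∈ rotations σ → Rotation σ ρ
∈-rotations⁻ {σ = σ} ρ∈ with ∈-map⁻ (λ i → rotate i σ) {xs = upTo (suc (length σ))} ρ∈
... | i , _ , ρ≡ = take i σ , drop i σ , sym (take++drop≡id i σ) , ρ≡

∈-rotations⁺ : Rotation σ ρ → ρ ∈ rotations σ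
∈-rotations⁺ (u , v , refl , refl) =
  subst (_∈ rotations (u ++ v)) (cong₂ _++_ (drop-length-++ u v) (take-length-++ u v))
        (∈-map⁺ (λ i → rotate i (u ++ v)) (∈-upTo⁺ (s≤s (length-++-≤ˡ u))))

eqList⇒≡ : ∀ σ τ → T (eqList σ τ) → σ ≡ τ
eqList⇒≡ []      []      _ = refl
eqList⇒≡ (x ∷ σ) (y ∷ τ) h with T-∧⁻ (x ≡ᵇ y) h
... | x≡ᵇy , σ≋τ = cong₂ _∷_ (≡ᵇ⇒≡ x y x≡ᵇy) (eqList⇒≡ σ τ σ≋τ)

eqList-refl : ∀ σ → T (eqList σ σ)
eqList-refl []      = _
eqList-refl (x ∷ σ) = Equivalence.from T-∧ (≡⇒≡ᵇ x x refl , eqList-refl σ)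

sameCyclic⁻ : ∀ σ τ → T (sameCyclic σ τ) → Rotation σ τ
sameCyclic⁻ σ τ h with find (Any.any⁻ _ (rotations σ) h)
... | ρ , ρ∈ , τ≋ρ = subst (Rotation σ) (sym (eqList⇒≡ τ ρ τ≋ρ)) (∈-rotations⁻ ρ∈)

sameCyclic⁺ : Rotation σ τ → T (sameCyclic σ τ)
sameCyclic⁺ {τ = τ} σ→τ = Any.any⁺ _ (lose (∈-rotations⁺ σ→τ) (eqList-refl τ))

sameCyclic-sym : ∀ σ τ → sameCyclic σ τ ≡ sameCyclic τ σ
sameCyclic-sym σ τ =
  T⇔T⇒≡ (mk⇔ (sameCyclic⁺ ∘ Rotation-sym ∘ sameCyclic⁻ σ τ)
             (sameCyclic⁺ ∘ Rotation-sym ∘ sameCyclic⁻ τ σ))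

sameCyclic-resp : T (sameCyclic σ τ) → ∀ ρ → sameCyclic σ ρ ≡ sameCyclic τ ρ
sameCyclic-resp {σ = σ} {τ = τ} σ~τ ρ = T⇔T⇒≡ (mk⇔
  (λ σ~ρ → sameCyclic⁺ (Rotation-trans (Rotation-sym σ→τ) (sameCyclic⁻ σ ρ σ~ρ)))
  (λ τ~ρ → sameCyclic⁺ (Rotation-trans σ→τ (sameCyclic⁻ τ ρ τ~ρ))))
  where σ→τ = sameCyclic⁻ σ τ σ~τ

contains⁻ : T (contains σ π) → ∃ λ s → T (orderIso π s) × s ⊆ σ
contains⁻ {σ = σ} h with find (Any.any⁻ _ (subseqs σ) h)
... | s , s∈ , iso = s , iso , ∈-subseqs⁻ σ s∈

contains⁺ : T (orderIso π s) → s ⊆ σ → T (contains σ π)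
contains⁺ iso s⊆σ = Any.any⁺ _ (lose (∈-subseqs⁺ s⊆σ) iso)

cycContains⁻ : T (cycContains σ π) → ∃₂ λ s r → T (orderIso π s) × Rotation s r × r ⊆ σ
cycContains⁻ {σ = σ} {π = π} h with find (Any.any⁻ _ (rotations σ) h)
... | ρ , ρ∈ , hρ with contains⁻ {π = π} hρ
...   | s , iso , s⊆ρ with ⊆-Rotation (∈-rotations⁻ ρ∈) s⊆ρ
...     | r , s→r , r⊆σ = s , r , iso , s→r , r⊆σ

cycContains⁺ : T (orderIso π s) → Rotation s r → r ⊆ σ → T (cycContains σ π)
cycContains⁺ {π = π} iso s→r r⊆σ with Rotation-⊆ s→r r⊆σ
... | ρ , σ→ρ , s⊆ρ = Any.any⁺ _ (lose (∈-rotations⁺ σ→ρ) (contains⁺ {π = π} iso s⊆ρ))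

cycContains-Rotation : Rotation σ σ′ → T (cycContains σ π) → T (cycContains σ′ π)
cycContains-Rotation {σ = σ} σ→σ′ h with find (Any.any⁻ _ (rotations σ) h)
... | ρ , ρ∈ , hρ =
  Any.any⁺ _ (lose (∈-rotations⁺ (Rotation-trans (Rotation-sym σ→σ′) (∈-rotations⁻ ρ∈))) hρ)

cycAvoidsAll-Rotation : ∀ Π → Rotation σ ρ → cycAvoidsAll Π σ ≡ cycAvoidsAll Π ρ
cycAvoidsAll-Rotation Π σ→ρ = cong and (map-cong (λ π → cong not (T⇔T⇒≡
  (mk⇔ (cycContains-Rotation {π = π} σ→ρ) (cycContains-Rotation {π = π} (Rotation-sym σ→ρ))))) Π)

data OrderIso : List ℕ → List ℕ → Set where
  []  : OrderIso [] []
  _∷_ : ∀ {p ps x xs} → Pointwise (λ q y → T (sameOrder p q x y)) ps xs →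
        OrderIso ps xs → OrderIso (p ∷ ps) (x ∷ xs)

headOK⇒Pointwise : ∀ p ps x xs → T (headOK p ps x xs) → Pointwise (λ q y → T (sameOrder p q x y)) ps xs
headOK⇒Pointwise p []       x []       _ = []
headOK⇒Pointwise p (q ∷ ps) x (y ∷ xs) h with T-∧⁻ (sameOrder p q x y) h
... | pq~xy , rest = pq~xy ∷ headOK⇒Pointwise p ps x xs rest

Pointwise⇒headOK : ∀ {p ps x xs} → Pointwise (λ q y → T (sameOrder p q x y)) ps xs → T (headOK p ps x xs)
Pointwise⇒headOK []             = _
Pointwise⇒headOK (pq~xy ∷ rest) = Equivalence.from T-∧ (pq~xy , Pointwise⇒headOK rest)

orderIso⇒OrderIso : ∀ π s → T (orderIso π s) → OrderIso π s
orderIso⇒OrderIso []      []      _ = []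
orderIso⇒OrderIso (p ∷ π) (x ∷ s) h with T-∧⁻ (headOK p π x s) h
... | hd , tl = headOK⇒Pointwise p π x s hd ∷ orderIso⇒OrderIso π s tl

OrderIso⇒orderIso : OrderIso π s → T (orderIso π s)
OrderIso⇒orderIso []        = _
OrderIso⇒orderIso (hd ∷ tl) = Equivalence.from T-∧ (Pointwise⇒headOK hd , OrderIso⇒orderIso tl)

<ᵇ-true : a < b → (a <ᵇ b) ≡ true
<ᵇ-true a<b = Equivalence.to T-≡ (<⇒<ᵇ a<b)

<ᵇ-false : b ≤ a → (a <ᵇ b) ≡ false
<ᵇ-false {b} {a} b≤a with a <ᵇ b in eq
... | false = refl
... | true  = contradiction b≤a (<⇒≱ (<ᵇ⇒< a b (subst T (sym eq) _)))

-- The side conditions T (p <ᵇ q) are left implicit: for numerals they reduce to ⊤.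

sameOrder-<⁻ : ∀ p q {_ : T (p <ᵇ q)} → T (sameOrder p q x y) → x < y
sameOrder-<⁻ {x = x} {y = y} p q {p<q} h with p <ᵇ q | p<q
... | true  | _ = <ᵇ⇒< x y (proj₁ (T-∧⁻ (x <ᵇ y) h))
... | false | ()

sameOrder->⁻ : ∀ p q {_ : T (q <ᵇ p)} → T (sameOrder p q x y) → y < x
sameOrder->⁻ {x = x} {y = y} p q {q<p} h with q <ᵇ p | q<p
... | true  | _ = <ᵇ⇒< y x (proj₂ (T-∧⁻ ((p <ᵇ q) ⇔ᵇ (x <ᵇ y)) h))
... | false | ()

sameOrder-<⁺ : ∀ p q {_ : T (p <ᵇ q)} → x < y → T (sameOrder p q x y)
sameOrder-<⁺ p q {p<q} x<y
  rewrite Equivalence.to T-≡ p<q | <ᵇ-false (<⇒≤ (<ᵇ⇒< p q p<q)) | <ᵇ-true x<y | <ᵇ-false (<⇒≤ x<y) = _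

sameOrder->⁺ : ∀ p q {_ : T (q <ᵇ p)} → y < x → T (sameOrder p q x y)
sameOrder->⁺ p q {q<p} y<x
  rewrite Equivalence.to T-≡ q<p | <ᵇ-false (<⇒≤ (<ᵇ⇒< q p q<p)) | <ᵇ-true y<x | <ᵇ-false (<⇒≤ y<x) = _

Shape₃ : Set
Shape₃ = ℕ → ℕ → ℕ → List ℕ

Shape₄ : Set
Shape₄ = ℕ → ℕ → ℕ → ℕ → List ℕ

record ShapeOf₃ (π : List ℕ) (shape : Shape₃) : Set where
  field
    read  : ∀ {s} → OrderIso π s → ∃[ a ] ∃[ b ] ∃[ c ] a < b × b < c × s ≡ shape a b c
    write : ∀ {a b c} → a < b → b < c → OrderIso π (shape a b c)

record ShapeOf₄ (π : List ℕ) (shape : Shape₄) : Set where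
  field
    read  : ∀ {s} → OrderIso π s →
            ∃[ a ] ∃[ b ] ∃[ c ] ∃[ d ] a < b × b < c × c < d × s ≡ shape a b c d
    write : ∀ {a b c d} → a < b → b < c → c < d → OrderIso π (shape a b c d)

Occurs₃ : Shape₃ → List ℕ → Set
Occurs₃ shape σ = ∃[ a ] ∃[ b ] ∃[ c ] a < b × b < c × shape a b c ⊆ σ

CyclicOccurs₄ : Shape₄ → List ℕ → Set
CyclicOccurs₄ shape σ =
  ∃[ a ] ∃[ b ] ∃[ c ] ∃[ d ] a < b × b < c × c < d × ∃[ r ] Rotation (shape a b c d) r × r ⊆ σ

Occurs₃-mono : ∀ {shape} → l ⊆ t → Occurs₃ shape l → Occurs₃ shape t
Occurs₃-mono l⊆t (a , b , c , a<b , b<c , occ) = a , b , c , a<b , b<c , ⊆-trans occ l⊆t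

contains⇔Occurs₃ : ∀ {shape} → ShapeOf₃ π shape → T (contains σ π) ⇔ Occurs₃ shape σ
contains⇔Occurs₃ {π = π} {σ = σ} {shape} S = mk⇔ to from
  where
    open ShapeOf₃ S
    to : T (contains σ π) → Occurs₃ shape σ
    to h with contains⁻ {π = π} h
    ... | s , iso , s⊆σ with read (orderIso⇒OrderIso π s iso)
    ...   | a , b , c , a<b , b<c , refl = a , b , c , a<b , b<c , s⊆σ
    from : Occurs₃ shape σ → T (contains σ π)
    from (a , b , c , a<b , b<c , occ) = contains⁺ {π = π} (OrderIso⇒orderIso (write a<b b<c)) occ

cycContains⇔CyclicOccurs₄ : ∀ {shape} → ShapeOf₄ π shape → T (cycContains σ π) ⇔ CyclicOccurs₄ shape σ
cycContains⇔CyclicOccurs₄ {π = π} {σ = σ} {shape} S = mk⇔ to from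
  where
    open ShapeOf₄ S
    to : T (cycContains σ π) → CyclicOccurs₄ shape σ
    to h with cycContains⁻ {π = π} h
    ... | s , r , iso , s→r , r⊆σ with read (orderIso⇒OrderIso π s iso)
    ...   | a , b , c , d , a<b , b<c , c<d , refl = a , b , c , d , a<b , b<c , c<d , r , s→r , r⊆σ
    from : CyclicOccurs₄ shape σ → T (cycContains σ π)
    from (a , b , c , d , a<b , b<c , c<d , r , s→r , r⊆σ) =
      cycContains⁺ {π = π} (OrderIso⇒orderIso (write a<b b<c c<d)) s→r r⊆σ

π123 π231 π132 π321 π1234 π1423 π1324 π1432 : List ℕ
π123  = 1 ∷ 2 ∷ 3 ∷ []
π231  = 2 ∷ 3 ∷ 1 ∷ []
π132  = 1 ∷ 3 ∷ 2 ∷ []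
π321  = 3 ∷ 2 ∷ 1 ∷ []
π1234 = 1 ∷ 2 ∷ 3 ∷ 4 ∷ []
π1423 = 1 ∷ 4 ∷ 2 ∷ 3 ∷ []
π1324 = 1 ∷ 3 ∷ 2 ∷ 4 ∷ []
π1432 = 1 ∷ 4 ∷ 3 ∷ 2 ∷ []

shape123 shape231 shape132 shape321 : Shape₃
shape123 a b c = a ∷ b ∷ c ∷ []
shape231 a b c = b ∷ c ∷ a ∷ []
shape132 a b c = a ∷ c ∷ b ∷ []
shape321 a b c = c ∷ b ∷ a ∷ []

shape1234 shape1423 shape1324 shape1432 : Shape₄
shape1234 a b c d = a ∷ b ∷ c ∷ d ∷ []
shape1423 a b c d = a ∷ d ∷ b ∷ c ∷ []
shape1324 a b c d = a ∷ c ∷ b ∷ d ∷ []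
shape1432 a b c d = a ∷ d ∷ c ∷ b ∷ []

shapeOf123 : ShapeOf₃ π123 shape123
ShapeOf₃.read shapeOf123 ((s₁₂ ∷ _ ∷ []) ∷ (s₂₃ ∷ []) ∷ [] ∷ []) =
  _ , _ , _ , sameOrder-<⁻ 1 2 s₁₂ , sameOrder-<⁻ 2 3 s₂₃ , refl
ShapeOf₃.write shapeOf123 a<b b<c =
  (sameOrder-<⁺ 1 2 a<b ∷ sameOrder-<⁺ 1 3 (<-trans a<b b<c) ∷ []) ∷ (sameOrder-<⁺ 2 3 b<c ∷ []) ∷ [] ∷ []

shapeOf231 : ShapeOf₃ π231 shape231
ShapeOf₃.read shapeOf231 ((s₁₂ ∷ s₁₃ ∷ []) ∷ _ ∷ [] ∷ []) =
  _ , _ , _ , sameOrder->⁻ 2 1 s₁₃ , sameOrder-<⁻ 2 3 s₁₂ , refl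
ShapeOf₃.write shapeOf231 a<b b<c =
  (sameOrder-<⁺ 2 3 b<c ∷ sameOrder->⁺ 2 1 a<b ∷ []) ∷ (sameOrder->⁺ 3 1 (<-trans a<b b<c) ∷ []) ∷ [] ∷ []

shapeOf132 : ShapeOf₃ π132 shape132
ShapeOf₃.read shapeOf132 ((_ ∷ s₁₃ ∷ []) ∷ (s₂₃ ∷ []) ∷ [] ∷ []) =
  _ , _ , _ , sameOrder-<⁻ 1 2 s₁₃ , sameOrder->⁻ 3 2 s₂₃ , refl
ShapeOf₃.write shapeOf132 a<b b<c =
  (sameOrder-<⁺ 1 3 (<-trans a<b b<c) ∷ sameOrder-<⁺ 1 2 a<b ∷ []) ∷ (sameOrder->⁺ 3 2 b<c ∷ []) ∷ [] ∷ []

shapeOf321 : ShapeOf₃ π321 shape321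
ShapeOf₃.read shapeOf321 ((s₁₂ ∷ _ ∷ []) ∷ (s₂₃ ∷ []) ∷ [] ∷ []) =
  _ , _ , _ , sameOrder->⁻ 2 1 s₂₃ , sameOrder->⁻ 3 2 s₁₂ , refl
ShapeOf₃.write shapeOf321 a<b b<c =
  (sameOrder->⁺ 3 2 b<c ∷ sameOrder->⁺ 3 1 (<-trans a<b b<c) ∷ []) ∷ (sameOrder->⁺ 2 1 a<b ∷ []) ∷ [] ∷ []

shapeOf1234 : ShapeOf₄ π1234 shape1234
ShapeOf₄.read shapeOf1234 ((s₁₂ ∷ _ ∷ _ ∷ []) ∷ (s₂₃ ∷ _ ∷ []) ∷ (s₃₄ ∷ []) ∷ [] ∷ []) =
  _ , _ , _ , _ , sameOrder-<⁻ 1 2 s₁₂ , sameOrder-<⁻ 2 3 s₂₃ , sameOrder-<⁻ 3 4 s₃₄ , refl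
ShapeOf₄.write shapeOf1234 a<b b<c c<d =
  (sameOrder-<⁺ 1 2 a<b ∷ sameOrder-<⁺ 1 3 a<c ∷ sameOrder-<⁺ 1 4 (<-trans a<b b<d) ∷ []) ∷
  (sameOrder-<⁺ 2 3 b<c ∷ sameOrder-<⁺ 2 4 b<d ∷ []) ∷ (sameOrder-<⁺ 3 4 c<d ∷ []) ∷ [] ∷ []
  where a<c = <-trans a<b b<c
        b<d = <-trans b<c c<d

shapeOf1423 : ShapeOf₄ π1423 shape1423
ShapeOf₄.read shapeOf1423 ((_ ∷ s₁₃ ∷ _ ∷ []) ∷ (_ ∷ s₂₄ ∷ []) ∷ (s₃₄ ∷ []) ∷ [] ∷ []) =
  _ , _ , _ , _ , sameOrder-<⁻ 1 2 s₁₃ , sameOrder-<⁻ 2 3 s₃₄ , sameOrder->⁻ 4 3 s₂₄ , refl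
ShapeOf₄.write shapeOf1423 a<b b<c c<d =
  (sameOrder-<⁺ 1 4 (<-trans a<b b<d) ∷ sameOrder-<⁺ 1 2 a<b ∷ sameOrder-<⁺ 1 3 (<-trans a<b b<c) ∷ []) ∷
  (sameOrder->⁺ 4 2 b<d ∷ sameOrder->⁺ 4 3 c<d ∷ []) ∷ (sameOrder-<⁺ 2 3 b<c ∷ []) ∷ [] ∷ []
  where b<d = <-trans b<c c<d

shapeOf1324 : ShapeOf₄ π1324 shape1324
ShapeOf₄.read shapeOf1324 ((_ ∷ s₁₃ ∷ _ ∷ []) ∷ (s₂₃ ∷ s₂₄ ∷ []) ∷ _ ∷ [] ∷ []) =
  _ , _ , _ , _ , sameOrder-<⁻ 1 2 s₁₃ , sameOrder->⁻ 3 2 s₂₃ , sameOrder-<⁻ 3 4 s₂₄ , refl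
ShapeOf₄.write shapeOf1324 a<b b<c c<d =
  (sameOrder-<⁺ 1 3 a<c ∷ sameOrder-<⁺ 1 2 a<b ∷ sameOrder-<⁺ 1 4 (<-trans a<c c<d) ∷ []) ∷
  (sameOrder->⁺ 3 2 b<c ∷ sameOrder-<⁺ 3 4 c<d ∷ []) ∷ (sameOrder-<⁺ 2 4 (<-trans b<c c<d) ∷ []) ∷ [] ∷ []
  where a<c = <-trans a<b b<c

shapeOf1432 : ShapeOf₄ π1432 shape1432
ShapeOf₄.read shapeOf1432 ((_ ∷ _ ∷ s₁₄ ∷ []) ∷ (s₂₃ ∷ _ ∷ []) ∷ (s₃₄ ∷ []) ∷ [] ∷ []) =
  _ , _ , _ , _ , sameOrder-<⁻ 1 2 s₁₄ , sameOrder->⁻ 3 2 s₃₄ , sameOrder->⁻ 4 3 s₂₃ , refl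
ShapeOf₄.write shapeOf1432 a<b b<c c<d =
  (sameOrder-<⁺ 1 4 (<-trans a<c c<d) ∷ sameOrder-<⁺ 1 3 a<c ∷ sameOrder-<⁺ 1 2 a<b ∷ []) ∷
  (sameOrder->⁺ 4 3 c<d ∷ sameOrder->⁺ 4 2 (<-trans b<c c<d) ∷ []) ∷ (sameOrder->⁺ 3 2 b<c ∷ []) ∷ [] ∷ []
  where a<c = <-trans a<b b<c

-- Cyclic occurrences in m ∷ τ, for τ below m

avoidsAll : List (List ℕ) → List ℕ → Bool
avoidsAll Π τ = all (λ π → not (contains τ π)) Π

avoids123-231 : List ℕ → Bool
avoids123-231 = avoidsAll (π123 ∷ π231 ∷ [])

Occurs123-231 : List ℕ → Set
Occurs123-231 τ = Occurs₃ shape123 τ ⊎ Occurs₃ shape231 τ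

avoids123-231⇔ : T (avoids123-231 τ) ⇔ (¬ Occurs123-231 τ)
avoids123-231⇔ {τ = τ} =
  subst (λ c → T c ⇔ (¬ Occurs123-231 τ)) (sym (all-not≡not-any (contains τ) (π123 ∷ π231 ∷ [])))
    (⇔.trans T-not (mk⇔ (_∘ Equivalence.from occurs⇔) (_∘ Equivalence.to occurs⇔)))
  where
    occurs⇔ : T (any (contains τ) (π123 ∷ π231 ∷ [])) ⇔ Occurs123-231 τ
    occurs⇔ = ⇔.trans (T-any-pair (contains τ) π123 π231)
                      (contains⇔Occurs₃ shapeOf123 ⊎-⇔ contains⇔Occurs₃ shapeOf231)

⊆-skip-max : All (_< m) τ → x ∷ r ⊆ m ∷ τ → Any (x <_) r → x ∷ r ⊆ τ
⊆-skip-max τ<m x∷r⊆ x<r = ∷ʳ⁻ x≢m x∷r⊆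
  where
    x≢m : _ ≡ _ → ⊥
    x≢m refl = All.lookupWith (λ y<m m<y → <-asym m<y y<m) (All-resp-⊆ (∷⁻ x∷r⊆) τ<m) x<r

-- Of the four rotations of an occurrence a < b < c < d, only the one starting with d can use the
-- head m; in each case the rotation without its head, or the whole rotation, contains a 3-pattern.

cyclic-1234-1423⇒ : All (_< m) τ → CyclicOccurs₄ shape1234 (m ∷ τ) ⊎ CyclicOccurs₄ shape1423 (m ∷ τ) →
                    Occurs123-231 τ
cyclic-1234-1423⇒ τ<m (inj₁ (a , b , c , d , a<b , b<c , c<d , r , rot , r⊆)) with Rotation-∷₄ rot
... | inj₁ refl               = inj₁ (b , c , d , b<c , c<d , ∷⁻ r⊆)
... | inj₂ (inj₁ refl)        = inj₂ (a , c , d , <-trans a<b b<c , c<d , ∷⁻ r⊆)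
... | inj₂ (inj₂ (inj₁ refl)) = inj₂ (a , c , d , <-trans a<b b<c , c<d ,
                                  ⊆-trans (refl ∷ refl ∷ refl ∷ _ ∷ʳ []) (⊆-skip-max τ<m r⊆ (here c<d)))
... | inj₂ (inj₂ (inj₂ refl)) = inj₁ (a , b , c , a<b , b<c , ∷⁻ r⊆)
cyclic-1234-1423⇒ τ<m (inj₂ (a , b , c , d , a<b , b<c , c<d , r , rot , r⊆)) with Rotation-∷₄ rot
... | inj₁ refl               = inj₁ (a , b , c , a<b , b<c ,
                                  ⊆-trans (refl ∷ _ ∷ʳ refl ∷ refl ∷ [])
                                          (⊆-skip-max τ<m r⊆ (here (<-trans a<b (<-trans b<c c<d)))))
... | inj₂ (inj₁ refl)        = inj₂ (a , b , c , a<b , b<c , ∷⁻ r⊆)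
... | inj₂ (inj₂ (inj₁ refl)) = inj₂ (a , b , c , a<b , b<c ,
                                  ⊆-trans (refl ∷ refl ∷ refl ∷ _ ∷ʳ []) (⊆-skip-max τ<m r⊆ (here b<c)))
... | inj₂ (inj₂ (inj₂ refl)) = inj₂ (b , c , d , b<c , c<d ,
                                  ⊆-trans (refl ∷ _ ∷ʳ refl ∷ refl ∷ []) (⊆-skip-max τ<m r⊆ (there (here c<d))))

cyclic-1324-1432⇒ : All (_< m) τ → CyclicOccurs₄ shape1324 (m ∷ τ) ⊎ CyclicOccurs₄ shape1432 (m ∷ τ) →
                    Occurs₃ shape132 τ ⊎ Occurs₃ shape321 τ
cyclic-1324-1432⇒ τ<m (inj₁ (a , b , c , d , a<b , b<c , c<d , r , rot , r⊆)) with Rotation-∷₄ rot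
... | inj₁ refl               = inj₁ (a , b , c , a<b , b<c ,
                                  ⊆-trans (refl ∷ refl ∷ refl ∷ _ ∷ʳ []) (⊆-skip-max τ<m r⊆ (here (<-trans a<b b<c))))
... | inj₂ (inj₁ refl)        = inj₂ (a , b , c , a<b , b<c ,
                                  ⊆-trans (refl ∷ refl ∷ _ ∷ʳ refl ∷ []) (⊆-skip-max τ<m r⊆ (there (here c<d))))
... | inj₂ (inj₂ (inj₁ refl)) = inj₁ (b , c , d , b<c , c<d ,
                                  ⊆-trans (refl ∷ refl ∷ _ ∷ʳ refl ∷ []) (⊆-skip-max τ<m r⊆ (here (<-trans b<c c<d))))
... | inj₂ (inj₂ (inj₂ refl)) = inj₁ (a , b , c , a<b , b<c , ∷⁻ r⊆)
cyclic-1324-1432⇒ τ<m (inj₂ (a , b , c , d , a<b , b<c , c<d , r , rot , r⊆)) with Rotation-∷₄ rot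
... | inj₁ refl               = inj₂ (b , c , d , b<c , c<d , ∷⁻ r⊆)
... | inj₂ (inj₁ refl)        = inj₂ (a , b , c , a<b , b<c , ∷⁻ r⊆)
... | inj₂ (inj₂ (inj₁ refl)) = inj₂ (a , b , c , a<b , b<c ,
                                  ⊆-trans (refl ∷ refl ∷ refl ∷ _ ∷ʳ [])
                                          (⊆-skip-max τ<m r⊆ (there (there (here c<d)))))
... | inj₂ (inj₂ (inj₂ refl)) = inj₁ (a , c , d , <-trans a<b b<c , c<d , ∷⁻ r⊆)

cyclic-1234-1423⇐ : All (_< m) τ → Occurs123-231 τ →
                    CyclicOccurs₄ shape1234 (m ∷ τ) ⊎ CyclicOccurs₄ shape1423 (m ∷ τ)
cyclic-1234-1423⇐ {m = m} τ<m (inj₁ (a , b , c , a<b , b<c , abc⊆τ)) with All-resp-⊆ abc⊆τ τ<m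
... | _ ∷ _ ∷ c<m ∷ [] =
  inj₁ (a , b , c , m , a<b , b<c , c<m , _ , (a ∷ b ∷ c ∷ [] , m ∷ [] , refl , refl) , refl ∷ abc⊆τ)
cyclic-1234-1423⇐ {m = m} τ<m (inj₂ (a , b , c , a<b , b<c , bca⊆τ)) with All-resp-⊆ bca⊆τ τ<m
... | _ ∷ c<m ∷ _ ∷ [] =
  inj₂ (a , b , c , m , a<b , b<c , c<m , _ , (a ∷ [] , m ∷ b ∷ c ∷ [] , refl , refl) , refl ∷ bca⊆τ)

cyclic-1324-1432⇐ : All (_< m) τ → Occurs₃ shape132 τ ⊎ Occurs₃ shape321 τ →
                    CyclicOccurs₄ shape1324 (m ∷ τ) ⊎ CyclicOccurs₄ shape1432 (m ∷ τ)
cyclic-1324-1432⇐ {m = m} τ<m (inj₁ (a , b , c , a<b , b<c , acb⊆τ)) with All-resp-⊆ acb⊆τ τ<m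
... | _ ∷ c<m ∷ _ ∷ [] =
  inj₁ (a , b , c , m , a<b , b<c , c<m , _ , (a ∷ c ∷ b ∷ [] , m ∷ [] , refl , refl) , refl ∷ acb⊆τ)
cyclic-1324-1432⇐ {m = m} τ<m (inj₂ (a , b , c , a<b , b<c , cba⊆τ)) with All-resp-⊆ cba⊆τ τ<m
... | c<m ∷ _ ∷ _ ∷ [] =
  inj₂ (a , b , c , m , a<b , b<c , c<m , _ , (a ∷ [] , m ∷ c ∷ b ∷ [] , refl , refl) , refl ∷ cba⊆τ)

cycAvoids1234-1423≡avoids123-231 : All (_< m) τ → cycAvoidsAll (π1234 ∷ π1423 ∷ []) (m ∷ τ) ≡ avoids123-231 τ
cycAvoids1234-1423≡avoids123-231 {m = m} {τ = τ} τ<m =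
  all-not-pair-cong (cycContains (m ∷ τ)) (contains τ) π1234 π1423 π123 π231
  (⇔.trans (cycContains⇔CyclicOccurs₄ shapeOf1234 ⊎-⇔ cycContains⇔CyclicOccurs₄ shapeOf1423)
  (⇔.trans (mk⇔ (cyclic-1234-1423⇒ τ<m) (cyclic-1234-1423⇐ τ<m))
           (⇔.sym (contains⇔Occurs₃ shapeOf123 ⊎-⇔ contains⇔Occurs₃ shapeOf231))))

cycAvoids1324-1432≡avoids132-321 : All (_< m) τ →
                                   cycAvoidsAll (π1324 ∷ π1432 ∷ []) (m ∷ τ) ≡ avoidsAll (π132 ∷ π321 ∷ []) τ
cycAvoids1324-1432≡avoids132-321 {m = m} {τ = τ} τ<m =
  all-not-pair-cong (cycContains (m ∷ τ)) (contains τ) π1324 π1432 π132 π321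
  (⇔.trans (cycContains⇔CyclicOccurs₄ shapeOf1324 ⊎-⇔ cycContains⇔CyclicOccurs₄ shapeOf1432)
  (⇔.trans (mk⇔ (cyclic-1324-1432⇒ τ<m) (cyclic-1324-1432⇐ τ<m))
           (⇔.sym (contains⇔Occurs₃ shapeOf132 ⊎-⇔ contains⇔Occurs₃ shapeOf321))))

Occurs₃-reverse : ∀ {w w′ : Shape₃} → (∀ a b c → w′ a b c ≡ reverse (w a b c)) →
                  Occurs₃ w τ ⇔ Occurs₃ w′ (reverse τ)
Occurs₃-reverse w′≡ = mk⇔
  (λ (a , b , c , a<b , b<c , occ) → a , b , c , a<b , b<c , subst (_⊆ _) (sym (w′≡ a b c)) (reverse⁺ occ))
  (λ (a , b , c , a<b , b<c , occ) → a , b , c , a<b , b<c , reverse⁻ (subst (_⊆ _) (w′≡ a b c) occ))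

avoids132-321≡avoids123-231∘reverse : ∀ τ → avoidsAll (π132 ∷ π321 ∷ []) τ ≡ avoids123-231 (reverse τ)
avoids132-321≡avoids123-231∘reverse τ =
  all-not-pair-cong (contains τ) (contains (reverse τ)) π132 π321 π123 π231
  (⇔.trans (contains⇔Occurs₃ {σ = τ} shapeOf132 ⊎-⇔ contains⇔Occurs₃ {σ = τ} shapeOf321)
  (⇔.trans (Occurs₃-reverse {τ = τ} (λ _ _ _ → refl) ⊎-⇔ Occurs₃-reverse {τ = τ} (λ _ _ _ → refl))
  (⇔.trans (mk⇔ ⊎-swap ⊎-swap)
           (⇔.sym (contains⇔Occurs₃ {σ = reverse τ} shapeOf123 ⊎-⇔ contains⇔Occurs₃ shapeOf231)))))

-- Permutations

∈-inserts⁻ : ∀ τ → σ ∈ inserts x τ → ∃₂ λ t₁ t₂ → τ ≡ t₁ ++ t₂ × σ ≡ t₁ ++ x ∷ t₂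
∈-inserts⁻ []      (here refl) = [] , [] , refl , refl
∈-inserts⁻ (y ∷ τ) (here refl) = [] , y ∷ τ , refl , refl
∈-inserts⁻ (y ∷ τ) (there σ∈) with ∈-map⁻ (y ∷_) σ∈
... | σ′ , σ′∈ , refl with ∈-inserts⁻ τ σ′∈
...   | t₁ , t₂ , refl , refl = y ∷ t₁ , t₂ , refl , refl

∈-inserts⁺ : ∀ t₁ t₂ → t₁ ++ x ∷ t₂ ∈ inserts x (t₁ ++ t₂)
∈-inserts⁺ []       []      = here refl
∈-inserts⁺ []       (y ∷ _) = here refl
∈-inserts⁺ (y ∷ t₁) t₂      = there (∈-map⁺ (y ∷_) (∈-inserts⁺ t₁ t₂))

∈-perms-suc⁻ : ∀ m → σ ∈ perms (suc m) → ∃₂ λ t₁ t₂ → σ ≡ t₁ ++ m ∷ t₂ × t₁ ++ t₂ ∈ perms m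
∈-perms-suc⁻ m σ∈ with find (∈-concatMap⁻ (inserts m) {xs = perms m} σ∈)
... | τ , τ∈ , σ∈ins with ∈-inserts⁻ τ σ∈ins
...   | t₁ , t₂ , refl , refl = t₁ , t₂ , refl , τ∈

∈-perms-suc⁺ : t₁ ++ t₂ ∈ perms m → t₁ ++ m ∷ t₂ ∈ perms (suc m)
∈-perms-suc⁺ {t₁ = t₁} {t₂} {m} τ∈ = ∈-concatMap⁺ (inserts m) (lose τ∈ (∈-inserts⁺ t₁ t₂))

∈-perms⇒↭ : ∀ m → σ ∈ perms m → σ ↭ upTo m
∈-perms⇒↭ zero    (here refl) = ↭-refl
∈-perms⇒↭ (suc m) σ∈ with ∈-perms-suc⁻ m σ∈
... | t₁ , t₂ , refl , τ∈ = begin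
  t₁ ++ m ∷ t₂     ↭⟨ shift m t₁ t₂ ⟩
  m ∷ t₁ ++ t₂     ↭⟨ ↭-prep m (∈-perms⇒↭ m τ∈) ⟩
  m ∷ upTo m       ↭⟨ ∷↭∷ʳ m (upTo m) ⟩
  upTo m ++ m ∷ [] ≡⟨ upTo-∷ʳ m ⟩
  upTo (suc m)     ∎
  where open PermutationReasoning

↭⇒∈-perms : ∀ m → σ ↭ upTo m → σ ∈ perms m
↭⇒∈-perms zero    p rewrite ↭-empty-inv p = here refl
↭⇒∈-perms (suc m) p with ∈-∃++ (Any-resp-↭ (↭-sym p) (∈-upTo⁺ (n<1+n m)))
... | t₁ , t₂ , refl = ∈-perms-suc⁺ (↭⇒∈-perms m (subst (_ ↭_) (++-identityʳ (upTo m)) τ↭))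
  where
    τ↭ : t₁ ++ t₂ ↭ upTo m ++ []
    τ↭ = drop-mid t₁ (upTo m) (↭-trans p (↭-reflexive (sym (upTo-∷ʳ m))))

perms-bounded : ∀ m → σ ∈ perms m → All (_< m) σ
perms-bounded m σ∈ = All-resp-↭ (↭-sym (∈-perms⇒↭ m σ∈)) (All.tabulate ∈-upTo⁻)

perms-length : ∀ m → σ ∈ perms m → length σ ≡ m
perms-length m σ∈ = trans (↭-length (∈-perms⇒↭ m σ∈)) (length-upTo m)

perms-Unique : ∀ m → σ ∈ perms m → Unique σ
perms-Unique m σ∈ =
  Permutationₛ.Unique-resp-↭ (setoid ℕ) (↭⇒↭ₛ (↭-sym (∈-perms⇒↭ m σ∈))) (Unique.upTo⁺ m)

perms-Rotation : ∀ m → Rotation σ ρ → σ ∈ perms m → ρ ∈ perms m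
perms-Rotation m σ→ρ σ∈ = ↭⇒∈-perms m (↭-trans (↭-sym (Rotation⇒↭ σ→ρ)) (∈-perms⇒↭ m σ∈))

perms-reverse : ∀ m → σ ∈ perms m → reverse σ ∈ perms m
perms-reverse {σ = σ} m σ∈ = ↭⇒∈-perms m (↭-trans (↭-reverse σ) (∈-perms⇒↭ m σ∈))

perms-tail-bounded : ∀ m → m ∷ τ ∈ perms (suc m) → All (_< m) τ
perms-tail-bounded m σ∈ with perms-bounded (suc m) σ∈ | perms-Unique (suc m) σ∈
... | _ ∷ τ<1+m | m∉τ ∷ _ =
  All.zipWith (λ (y<1+m , m≢y) → ≤∧≢⇒< (s≤s⁻¹ y<1+m) (m≢y ∘ sym)) (τ<1+m , m∉τ)

Unique-inserts : All (_< x) τ → Unique (inserts x τ)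
Unique-inserts []          = [] ∷ []
Unique-inserts (y<x ∷ τ<x) =
  All.map⁺ (All.tabulate λ _ eq → <-irrefl (sym (∷-injectiveˡ eq)) y<x) ∷
  Unique.map⁺ ∷-injectiveʳ (Unique-inserts τ<x)

_≢?_ : ∀ y x → Dec (y ≢ x)
y ≢? x = ¬? (y ≟ x)

erase : ℕ → List ℕ → List ℕ
erase x = filter (_≢? x)

erase-inserts : All (_< x) τ → σ ∈ inserts x τ → erase x σ ≡ τ
erase-inserts {x = x} {τ = τ} τ<x σ∈ with ∈-inserts⁻ τ σ∈
... | t₁ , t₂ , refl , refl = begin
  erase x (t₁ ++ x ∷ t₂)         ≡⟨ filter-++ (_≢? x) t₁ (x ∷ t₂) ⟩
  erase x t₁ ++ erase x (x ∷ t₂) ≡⟨ cong (erase x t₁ ++_) (filter-reject (_≢? x) (λ x≢x → x≢x refl)) ⟩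
  erase x t₁ ++ erase x t₂       ≡⟨ cong₂ _++_ (filter-all (_≢? x) (≢x t₁<x)) (filter-all (_≢? x) (≢x t₂<x)) ⟩
  t₁ ++ t₂                       ∎
  where
    open ≡-Reasoning
    t₁<x = proj₁ (All.++⁻ t₁ τ<x)
    t₂<x = proj₂ (All.++⁻ t₁ τ<x)
    ≢x : ∀ {t} → All (_< x) t → All (_≢ x) t
    ≢x = All.map <⇒≢

Unique-concatMap-inserts : ∀ L → All (All (_< x)) L → Unique L → Unique (concatMap (inserts x) L)
Unique-concatMap-inserts []      []          []          = []
Unique-concatMap-inserts {x = x} (τ ∷ L) (τ<x ∷ L<x) (τ∉L ∷ uL) =
  Unique.++⁺ (Unique-inserts τ<x) (Unique-concatMap-inserts L L<x uL) disjoint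
  where
    disjoint : Disjoint (inserts x τ) (concatMap (inserts x) L)
    disjoint (σ∈ , σ∈L) with find (∈-concatMap⁻ (inserts x) {xs = L} σ∈L)
    ... | τ′ , τ′∈ , σ∈′ =
      All.lookup τ∉L τ′∈ (trans (sym (erase-inserts τ<x σ∈)) (erase-inserts (All.lookup L<x τ′∈) σ∈′))

Unique-perms : ∀ m → Unique (perms m)
Unique-perms zero    = [] ∷ []
Unique-perms (suc m) = Unique-concatMap-inserts (perms m) (All.tabulate (perms-bounded m)) (Unique-perms m)

map-reverse-perms : ∀ m → map reverse (perms m) ↭ perms m
map-reverse-perms m = ∼bag⇒↭ (unique∧set⇒bag (Unique.map⁺ reverse-injective (Unique-perms m)) (Unique-perms m)
                                               (mk⇔ to from))
  where
    to : ∀ {σ} → σ ∈ map reverse (perms m) → σ ∈ perms m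
    to σ∈ with ∈-map⁻ reverse σ∈
    ... | τ , τ∈ , refl = perms-reverse m τ∈
    from : ∀ {σ} → σ ∈ perms m → σ ∈ map reverse (perms m)
    from {σ} σ∈ = subst (_∈ map reverse (perms m)) (reverse-involutive σ) (∈-map⁺ reverse (perms-reverse m σ∈))

count : (List ℕ → Bool) → List (List ℕ) → ℕ
count p L = length (filterᵇ p L)

filterᵇ≡filter : ∀ (p : List ℕ → Bool) L → filterᵇ p L ≡ filter (T? ∘ p) L
filterᵇ≡filter p []      = refl
filterᵇ≡filter p (σ ∷ L) with p σ
... | true  = cong (σ ∷_) (filterᵇ≡filter p L)
... | false = filterᵇ≡filter p L

∈-filterᵇ⁻ : ∀ p → σ ∈ filterᵇ p L → σ ∈ L × T (p σ)
∈-filterᵇ⁻ {σ = σ} {L = L} p σ∈ = ∈-filter⁻ (T? ∘ p) (subst (σ ∈_) (filterᵇ≡filter p L) σ∈)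

∈-filterᵇ⁺ : ∀ p → σ ∈ L → T (p σ) → σ ∈ filterᵇ p L
∈-filterᵇ⁺ {σ = σ} {L = L} p σ∈ pσ = subst (σ ∈_) (sym (filterᵇ≡filter p L)) (∈-filter⁺ (T? ∘ p) σ∈ pσ)

AllPairs-filterᵇ : ∀ {R : List ℕ → List ℕ → Set} p → AllPairs R L → AllPairs R (filterᵇ p L)
AllPairs-filterᵇ {L = L} {R} p ps = subst (AllPairs R) (sym (filterᵇ≡filter p L)) (AllPairs.filter⁺ (T? ∘ p) ps)

filterᵇ-++ : ∀ (p : List ℕ → Bool) xs ys → filterᵇ p (xs ++ ys) ≡ filterᵇ p xs ++ filterᵇ p ys
filterᵇ-++ p []       ys = refl
filterᵇ-++ p (σ ∷ xs) ys with p σ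
... | true  = cong (σ ∷_) (filterᵇ-++ p xs ys)
... | false = filterᵇ-++ p xs ys

filterᵇ-comm : ∀ (p q : List ℕ → Bool) L → filterᵇ p (filterᵇ q L) ≡ filterᵇ q (filterᵇ p L)
filterᵇ-comm p q []      = refl
filterᵇ-comm p q (σ ∷ L) with q σ in qσ | p σ in pσ
... | true  | true  rewrite qσ | pσ = cong (σ ∷_) (filterᵇ-comm p q L)
... | true  | false rewrite pσ      = filterᵇ-comm p q L
... | false | true  rewrite qσ      = filterᵇ-comm p q L
... | false | false                 = filterᵇ-comm p q L

filterᵇ-map : ∀ (p : List ℕ → Bool) f L → filterᵇ p (map f L) ≡ map f (filterᵇ (p ∘ f) L)
filterᵇ-map p f []      = refl
filterᵇ-map p f (σ ∷ L) with p (f σ)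
... | true  = cong (f σ ∷_) (filterᵇ-map p f L)
... | false = filterᵇ-map p f L

filterᵇ-partition : ∀ (r : List ℕ → Bool) L → filterᵇ (not ∘ r) L ++ filterᵇ r L ↭ L
filterᵇ-partition r []      = ↭-refl
filterᵇ-partition r (σ ∷ L) with r σ
... | true  = ↭-trans (shift σ (filterᵇ (not ∘ r) L) (filterᵇ r L)) (↭-prep σ (filterᵇ-partition r L))
... | false = ↭-prep σ (filterᵇ-partition r L)

count-cong∈ : ∀ (p q : List ℕ → Bool) L → (∀ {σ} → σ ∈ L → p σ ≡ q σ) → count p L ≡ count q L
count-cong∈ p q L p≗q = cong length (filterᵇ-cong∈ L p≗q)
  where
    filterᵇ-cong∈ : ∀ L → (∀ {σ} → σ ∈ L → p σ ≡ q σ) → filterᵇ p L ≡ filterᵇ q L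
    filterᵇ-cong∈ []      _   = refl
    filterᵇ-cong∈ (σ ∷ L) p≗q rewrite p≗q (here refl) with q σ
    ... | true  = cong (σ ∷_) (filterᵇ-cong∈ L (p≗q ∘ there))
    ... | false = filterᵇ-cong∈ L (p≗q ∘ there)

count-reverse : ∀ (p : List ℕ → Bool) m → count (p ∘ reverse) (perms m) ≡ count p (perms m)
count-reverse p m = begin
  count (p ∘ reverse) (perms m)
    ≡⟨ length-map reverse (filterᵇ (p ∘ reverse) (perms m)) ⟨
  length (map reverse (filterᵇ (p ∘ reverse) (perms m)))
    ≡⟨ cong length (filterᵇ-map p reverse (perms m)) ⟨
  count p (map reverse (perms m))
    ≡⟨ cong length (filterᵇ≡filter p (map reverse (perms m))) ⟩
  length (filter (T? ∘ p) (map reverse (perms m)))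
    ≡⟨ ↭-length (filter-↭ (T? ∘ p) (map-reverse-perms m)) ⟩
  length (filter (T? ∘ p) (perms m))
    ≡⟨ cong length (filterᵇ≡filter p (perms m)) ⟨
  count p (perms m) ∎
  where open ≡-Reasoning

nested-if-swap : ∀ e x y c → (T e → x ≡ y) →
  (if e ∨ x then (if y then c else suc c) else suc (if y then c else suc c)) ≡
  (if e ∨ y then (if x then c else suc c) else suc (if x then c else suc c))
nested-if-swap true  x     y     c x≡y rewrite x≡y _ = refl
nested-if-swap false true  true  c _ = refl
nested-if-swap false true  false c _ = refl
nested-if-swap false false true  c _ = refl
nested-if-swap false false false c _ = refl

countClasses-↭ : xs ↭ ys → countClasses xs ≡ countClasses ys
countClasses-↭ ↭.refl = refl
countClasses-↭ (↭.prep σ p) rewrite any-↭ (sameCyclic σ) p | countClasses-↭ p = refl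
countClasses-↭ (↭.swap {ys = ys} σ τ p)
  rewrite any-↭ (sameCyclic σ) p | any-↭ (sameCyclic τ) p | countClasses-↭ p | sameCyclic-sym σ τ =
  nested-if-swap (sameCyclic τ σ) (any (sameCyclic σ) ys) (any (sameCyclic τ) ys) (countClasses ys)
    (λ τ~σ → sym (any-cong (sameCyclic-resp τ~σ) ys))
countClasses-↭ (↭.trans p q) = trans (countClasses-↭ p) (countClasses-↭ q)

countClasses-++ : ∀ xs ys → (∀ {σ} → σ ∈ xs → Any (T ∘ sameCyclic σ) ys) →
                  countClasses (xs ++ ys) ≡ countClasses ys
countClasses-++ []       ys _    = refl
countClasses-++ (σ ∷ xs) ys reps
  rewrite Equivalence.to T-≡ (Any.any⁺ (sameCyclic σ) (Any.++⁺ʳ xs (reps (here refl)))) =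
  countClasses-++ xs ys (reps ∘ there)

countClasses-length : AllPairs (λ σ τ → ¬ T (sameCyclic σ τ)) xs → countClasses xs ≡ length xs
countClasses-length []                    = refl
countClasses-length {xs = σ ∷ xs} (σ≁xs ∷ xs≁)
  rewrite ¬T⇒≡false (All.All¬⇒¬Any σ≁xs ∘ Any.any⁻ (sameCyclic σ) xs) = cong suc (countClasses-length xs≁)

countClasses-representatives : ∀ (r : List ℕ → Bool) L →
  (∀ {σ} → σ ∈ L → Any (T ∘ sameCyclic σ) (filterᵇ r L)) →
  AllPairs (λ σ τ → ¬ T (sameCyclic σ τ)) (filterᵇ r L) →
  countClasses L ≡ count r L
countClasses-representatives r L reps distinct = begin
  countClasses L                                    ≡⟨ countClasses-↭ (↭-sym (filterᵇ-partition r L)) ⟩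
  countClasses (filterᵇ (not ∘ r) L ++ filterᵇ r L) ≡⟨ countClasses-++ _ _ (reps ∘ proj₁ ∘ ∈-filterᵇ⁻ _) ⟩
  countClasses (filterᵇ r L)                        ≡⟨ countClasses-length distinct ⟩
  count r L                                         ∎
  where open ≡-Reasoning

AllPairs-All-map : ∀ {P : List ℕ → Set} {R S : List ℕ → List ℕ → Set} →
  (∀ {σ τ} → P σ → P τ → R σ τ → S σ τ) → All P xs → AllPairs R xs → AllPairs S xs
AllPairs-All-map f []         []         = []
AllPairs-All-map f (pσ ∷ pxs) (rσ ∷ rxs) =
  All.zipWith (λ (pτ , r) → f pσ pτ r) (pxs , rσ) ∷ AllPairs-All-map f pxs rxs

≡ᵇ-refl : ∀ m → (m ≡ᵇ m) ≡ true
≡ᵇ-refl m = Equivalence.to T-≡ (≡⇒≡ᵇ m m refl)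

startsWith : ℕ → List ℕ → Bool
startsWith m []      = false
startsWith m (x ∷ _) = x ≡ᵇ m

startsWith⁻ : ∀ σ → T (startsWith m σ) → ∃ λ τ → σ ≡ m ∷ τ
startsWith⁻ (x ∷ τ) h = τ , cong (_∷ τ) (≡ᵇ⇒≡ x _ h)

filterᵇ-startsWith-inserts : All (_< m) τ → filterᵇ (startsWith m) (inserts m τ) ≡ (m ∷ τ) ∷ []
filterᵇ-startsWith-inserts {m = m} [] rewrite ≡ᵇ-refl m = refl
filterᵇ-startsWith-inserts {m = m} {τ = y ∷ τ} (y<m ∷ _) rewrite ≡ᵇ-refl m =
  cong ((m ∷ y ∷ τ) ∷_) (begin
    filterᵇ (startsWith m) (map (y ∷_) (inserts m τ))
      ≡⟨ filterᵇ-map (startsWith m) (y ∷_) (inserts m τ) ⟩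
    map (y ∷_) (filterᵇ (λ _ → y ≡ᵇ m) (inserts m τ))
      ≡⟨ cong (map (y ∷_)) (filterᵇ-false y≢ᵇm (inserts m τ)) ⟩
    [] ∎)
  where
    open ≡-Reasoning
    y≢ᵇm : (y ≡ᵇ m) ≡ false
    y≢ᵇm = ¬T⇒≡false (λ h → <-irrefl (≡ᵇ⇒≡ y m h) y<m)
    filterᵇ-false : ∀ {b} → b ≡ false → ∀ L → filterᵇ (λ _ → b) L ≡ []
    filterᵇ-false refl []      = refl
    filterᵇ-false refl (_ ∷ L) = filterᵇ-false refl L

filterᵇ-startsWith-perms : ∀ m → filterᵇ (startsWith m) (perms (suc m)) ≡ map (m ∷_) (perms m)
filterᵇ-startsWith-perms m = go (perms m) (All.tabulate (perms-bounded m))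
  where
    go : ∀ L → All (All (_< m)) L → filterᵇ (startsWith m) (concatMap (inserts m) L) ≡ map (m ∷_) L
    go []      []          = refl
    go (τ ∷ L) (τ<m ∷ L<m) = begin
      filterᵇ (startsWith m) (inserts m τ ++ concatMap (inserts m) L)
        ≡⟨ filterᵇ-++ (startsWith m) (inserts m τ) _ ⟩
      filterᵇ (startsWith m) (inserts m τ) ++ filterᵇ (startsWith m) (concatMap (inserts m) L)
        ≡⟨ cong₂ _++_ (filterᵇ-startsWith-inserts τ<m) (go L L<m) ⟩
      (m ∷ τ) ∷ map (m ∷_) L ∎
      where open ≡-Reasoning

Rotation-∷-max⇒≡ : All (_< m) τ → Rotation (m ∷ τ) (m ∷ τ′) → τ ≡ τ′
Rotation-∷-max⇒≡ τ<m ([] , v , refl , eq) = ∷-injectiveʳ (sym (trans eq (++-identityʳ v)))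
Rotation-∷-max⇒≡ τ<m (_ ∷ u , [] , refl , refl) = ++-identityʳ u
Rotation-∷-max⇒≡ τ<m (_ ∷ u , _ ∷ v , refl , refl) =
  ⊥-elim (<-irrefl refl (All.lookup τ<m (∈-++⁺ʳ u (here refl))))

-- The representatives of the classes are the permutations starting with their maximum m.

numAv-suc : ∀ m Π → numAv (suc m) Π ≡ count (λ τ → cycAvoidsAll Π (m ∷ τ)) (perms m)
numAv-suc m Π = begin
  numAv (suc m) Π
    ≡⟨ countClasses-representatives (startsWith m) avoiders reps distinct ⟩
  count (startsWith m) avoiders
    ≡⟨ cong length (filterᵇ-comm (startsWith m) avoidsΠ (perms (suc m))) ⟩
  count avoidsΠ (filterᵇ (startsWith m) (perms (suc m)))
    ≡⟨ cong (count avoidsΠ) (filterᵇ-startsWith-perms m) ⟩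
  count avoidsΠ (map (m ∷_) (perms m))
    ≡⟨ cong length (filterᵇ-map avoidsΠ (m ∷_) (perms m)) ⟩
  length (map (m ∷_) (filterᵇ (avoidsΠ ∘ (m ∷_)) (perms m)))
    ≡⟨ length-map (m ∷_) (filterᵇ (avoidsΠ ∘ (m ∷_)) (perms m)) ⟩
  count (avoidsΠ ∘ (m ∷_)) (perms m) ∎
  where
    open ≡-Reasoning
    avoidsΠ = cycAvoidsAll Π
    avoiders = filterᵇ avoidsΠ (perms (suc m))
    reps : ∀ {σ} → σ ∈ avoiders → Any (T ∘ sameCyclic σ) (filterᵇ (startsWith m) avoiders)
    reps σ∈ with ∈-filterᵇ⁻ avoidsΠ σ∈
    ... | σ∈perms , avσ with ∈-perms-suc⁻ m σ∈perms
    ...   | t₁ , t₂ , refl , _ = lose ρ∈ (sameCyclic⁺ σ→ρ)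
      where
        σ→ρ : Rotation (t₁ ++ m ∷ t₂) (m ∷ t₂ ++ t₁)
        σ→ρ = t₁ , m ∷ t₂ , refl , refl
        ρ∈ = ∈-filterᵇ⁺ (startsWith m)
               (∈-filterᵇ⁺ avoidsΠ (perms-Rotation (suc m) σ→ρ σ∈perms)
                                   (subst T (cycAvoidsAll-Rotation Π σ→ρ) avσ))
               (≡⇒≡ᵇ m m refl)
    inequivalent : ∀ {σ τ} → σ ∈ perms (suc m) × T (startsWith m σ) →
                   τ ∈ perms (suc m) × T (startsWith m τ) → σ ≢ τ → ¬ T (sameCyclic σ τ)
    inequivalent {σ} {τ} (σ∈ , hσ) (_ , hτ) σ≢τ σ~τ with startsWith⁻ σ hσ | startsWith⁻ τ hτ
    ... | τ₁ , refl | τ₂ , refl =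
      σ≢τ (cong (m ∷_) (Rotation-∷-max⇒≡ (perms-tail-bounded m σ∈)
                                          (sameCyclic⁻ (m ∷ τ₁) (m ∷ τ₂) σ~τ)))
    distinct : AllPairs (λ σ τ → ¬ T (sameCyclic σ τ)) (filterᵇ (startsWith m) avoiders)
    distinct = AllPairs-All-map inequivalent
      (All.tabulate λ σ∈ → let σ∈av , hσ = ∈-filterᵇ⁻ (startsWith m) σ∈
                            in proj₁ (∈-filterᵇ⁻ avoidsΠ σ∈av) , hσ)
      (AllPairs-filterᵇ (startsWith m) (AllPairs-filterᵇ avoidsΠ (Unique-perms (suc m))))

-- Inserting the maximum into a permutation avoiding 123 and 231

nonIncreasing : List ℕ → Bool
nonIncreasing []          = true
nonIncreasing (x ∷ [])    = true
nonIncreasing (x ∷ y ∷ l) = not (x <ᵇ y) ∧ nonIncreasing (y ∷ l)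

lowerBound : ℕ → List ℕ → Bool
lowerBound x = all (λ y → not (y <ᵇ x))

below : List ℕ → List ℕ → Bool
below t₁ t₂ = all (λ x → lowerBound x t₂) t₁

insertionSafe : List ℕ → List ℕ → Bool
insertionSafe t₁ t₂ = nonIncreasing t₁ ∧ below t₁ t₂

Rising : List ℕ → Set
Rising t = ∃[ a ] ∃[ b ] a < b × a ∷ b ∷ [] ⊆ t

Crossing : List ℕ → List ℕ → Set
Crossing t₁ t₂ = ∃[ x ] ∃[ y ] y < x × x ∈ t₁ × y ∈ t₂

not<ᵇ⇒≥ : T (not (x <ᵇ y)) → y ≤ x
not<ᵇ⇒≥ h = ≮⇒≥ (λ x<y → Equivalence.to T-not h (<⇒<ᵇ x<y))

≥⇒not<ᵇ : y ≤ x → T (not (x <ᵇ y))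
≥⇒not<ᵇ {y = y} {x = x} y≤x = Equivalence.from T-not (λ h → <⇒≱ (<ᵇ⇒< x y h) y≤x)

nonIncreasing-tail : ∀ x l → T (nonIncreasing (x ∷ l)) → T (nonIncreasing l)
nonIncreasing-tail x []      _ = _
nonIncreasing-tail x (y ∷ l) h = proj₂ (T-∧⁻ (not (x <ᵇ y)) h)

nonIncreasing-head : ∀ x l → T (nonIncreasing (x ∷ l)) → y ∈ l → y ≤ x
nonIncreasing-head x (y ∷ l) h (here refl) = not<ᵇ⇒≥ (proj₁ (T-∧⁻ (not (x <ᵇ y)) h))
nonIncreasing-head x (y ∷ l) h (there z∈)  =
  ≤-trans (nonIncreasing-head y l (nonIncreasing-tail x (y ∷ l) h) z∈) (nonIncreasing-head x (y ∷ l) h (here refl))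

nonIncreasing⁺ : T (nonIncreasing t) → a ∷ b ∷ [] ⊆ t → b ≤ a
nonIncreasing⁺ {t = x ∷ t} h (refl ∷ p) = nonIncreasing-head x t h (to∈ p)
nonIncreasing⁺ {t = x ∷ t} h (_ ∷ʳ p)   = nonIncreasing⁺ (nonIncreasing-tail x t h) p

nonIncreasing⁻ : (∀ {a b} → a ∷ b ∷ [] ⊆ t → b ≤ a) → T (nonIncreasing t)
nonIncreasing⁻ {t = []}        _ = _
nonIncreasing⁻ {t = x ∷ []}    _ = _
nonIncreasing⁻ {t = x ∷ y ∷ t} h =
  Equivalence.from T-∧ (≥⇒not<ᵇ (h (refl ∷ refl ∷ []⊆-universal t)) , nonIncreasing⁻ (h ∘ (x ∷ʳ_)))

below⁺ : T (below t₁ t₂) → x ∈ t₁ → y ∈ t₂ → x ≤ y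
below⁺ {t₁ = t₁} {t₂ = t₂} h x∈ y∈ =
  not<ᵇ⇒≥ (All.lookup (All.all⁺ _ t₂ (All.lookup (All.all⁺ _ t₁ h) x∈)) y∈)

below⁻ : (∀ {x y} → x ∈ t₁ → y ∈ t₂ → x ≤ y) → T (below t₁ t₂)
below⁻ h = All.all⁻ _ (All.tabulate λ x∈ → All.all⁻ _ (All.tabulate λ y∈ → ≥⇒not<ᵇ (h x∈ y∈)))

occurrence-around-max : All (_< M) t₁ → All (_< M) t₂ → Occurs123-231 (t₁ ++ M ∷ t₂) →
                        Occurs123-231 (t₁ ++ t₂) ⊎ Rising t₁ ⊎ Crossing t₁ t₂
occurrence-around-max {M = M} {t₁ = t₁} {t₂ = t₂} t₁<M t₂<M (inj₁ (a , b , c , a<b , b<c , w⊆))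
  with ⊆-++-split t₁ (M ∷ t₂) w⊆
... | _ , _ , eq , p₁ , _ ∷ʳ p₂ = inj₁ (inj₁ (a , b , c , a<b , b<c , subst (_⊆ _) (sym eq) (++⁺ p₁ p₂)))
... | []                , _ , refl , _  , refl ∷ p₂ = ⊥-elim (<-asym a<b (All.head (All-resp-⊆ p₂ t₂<M)))
... | _ ∷ []            , _ , refl , _  , refl ∷ p₂ = ⊥-elim (<-asym b<c (All.head (All-resp-⊆ p₂ t₂<M)))
... | _ ∷ _ ∷ []        , _ , refl , p₁ , refl ∷ _  = inj₂ (inj₁ (a , b , a<b , p₁))
... | _ ∷ _ ∷ _ ∷ []    , _ , ()   , _  , refl ∷ _
... | _ ∷ _ ∷ _ ∷ _ ∷ _ , _ , ()   , _  , refl ∷ _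
occurrence-around-max {M = M} {t₁ = t₁} {t₂ = t₂} t₁<M t₂<M (inj₂ (a , b , c , a<b , b<c , w⊆))
  with ⊆-++-split t₁ (M ∷ t₂) w⊆
... | _ , _ , eq , p₁ , _ ∷ʳ p₂ = inj₁ (inj₂ (a , b , c , a<b , b<c , subst (_⊆ _) (sym eq) (++⁺ p₁ p₂)))
... | []                , _ , refl , _  , refl ∷ p₂ = ⊥-elim (<-asym b<c (All.head (All-resp-⊆ p₂ t₂<M)))
... | _ ∷ []            , _ , refl , p₁ , refl ∷ p₂ = inj₂ (inj₂ (b , a , a<b , to∈ p₁ , to∈ p₂))
... | _ ∷ _ ∷ []        , _ , refl , p₁ , refl ∷ _  = ⊥-elim (<-asym a<b (All.head (All-resp-⊆ p₁ t₁<M)))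
... | _ ∷ _ ∷ _ ∷ []    , _ , ()   , _  , refl ∷ _
... | _ ∷ _ ∷ _ ∷ _ ∷ _ , _ , ()   , _  , refl ∷ _

avoids-insert-max : All (_< M) (t₁ ++ t₂) →
                    avoids123-231 (t₁ ++ M ∷ t₂) ≡ avoids123-231 (t₁ ++ t₂) ∧ insertionSafe t₁ t₂
avoids-insert-max {M = M} {t₁ = t₁} {t₂ = t₂} bounded = T⇔T⇒≡ (mk⇔ to from)
  where
    t₁<M = proj₁ (All.++⁻ t₁ bounded)
    t₂<M = proj₂ (All.++⁻ t₁ bounded)
    widen : Occurs123-231 (t₁ ++ t₂) → Occurs123-231 (t₁ ++ M ∷ t₂)
    widen = ⊎-map (Occurs₃-mono M-free) (Occurs₃-mono M-free)
      where M-free = ++⁺ (⊆-refl {x = t₁}) (M ∷ʳ ⊆-refl)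
    rising : Rising t₁ → Occurs123-231 (t₁ ++ M ∷ t₂)
    rising (a , b , a<b , ab⊆) =
      inj₁ (a , b , M , a<b , All.lookup t₁<M (to∈ (∷ˡ⁻ ab⊆)) , ++⁺ ab⊆ (refl ∷ []⊆-universal t₂))
    crossing : Crossing t₁ t₂ → Occurs123-231 (t₁ ++ M ∷ t₂)
    crossing (x , y , y<x , x∈ , y∈) =
      inj₂ (y , x , M , y<x , All.lookup t₁<M x∈ , ++⁺ (from∈ x∈) (refl ∷ from∈ y∈))
    to : T (avoids123-231 (t₁ ++ M ∷ t₂)) → T (avoids123-231 (t₁ ++ t₂) ∧ insertionSafe t₁ t₂)
    to h = Equivalence.from T-∧ (Equivalence.from avoids123-231⇔ (¬occ ∘ widen) , Equivalence.from T-∧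
      ( nonIncreasing⁻ (λ ab⊆ → ≮⇒≥ (λ a<b → ¬occ (rising (_ , _ , a<b , ab⊆))))
      , below⁻ (λ x∈ y∈ → ≮⇒≥ (λ y<x → ¬occ (crossing (_ , _ , y<x , x∈ , y∈))))))
      where ¬occ = Equivalence.to avoids123-231⇔ h
    from : T (avoids123-231 (t₁ ++ t₂) ∧ insertionSafe t₁ t₂) → T (avoids123-231 (t₁ ++ M ∷ t₂))
    from h with T-∧⁻ (avoids123-231 (t₁ ++ t₂)) h
    ... | av , safe with T-∧⁻ (nonIncreasing t₁) safe
    ...   | ni , bl = Equivalence.from avoids123-231⇔ λ occ →
      [ Equivalence.to avoids123-231⇔ av
      , [ (λ (a , b , a<b , ab⊆) → <⇒≱ a<b (nonIncreasing⁺ ni ab⊆))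
        , (λ (x , y , y<x , x∈ , y∈) → <⇒≱ y<x (below⁺ bl x∈ y∈)) ] ] (occurrence-around-max t₁<M t₂<M occ)

insertAt : List ℕ → ℕ → ℕ → List ℕ
insertAt τ p x = take p τ ++ x ∷ drop p τ

safeAt : ℕ → List ℕ → Bool
safeAt k τ = insertionSafe (take k τ) (drop k τ)

avoids-insertAt : All (_< M) τ → avoids123-231 (insertAt τ p M) ≡ avoids123-231 τ ∧ safeAt p τ
avoids-insertAt {τ = τ} {p = p} τ<M = trans
  (avoids-insert-max {t₁ = take p τ} {t₂ = drop p τ} (subst (All _) (sym (take++drop≡id p τ)) τ<M))
  (cong (λ σ → avoids123-231 σ ∧ safeAt p τ) (take++drop≡id p τ))

safeAt-tail : ∀ k y τ → T (safeAt (suc k) (y ∷ τ)) → T (safeAt k τ)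
safeAt-tail k y τ h with T-∧⁻ (nonIncreasing (y ∷ take k τ)) h
... | ni , lb∧bl =
  Equivalence.from T-∧ (nonIncreasing-tail y (take k τ) ni , proj₂ (T-∧⁻ (lowerBound y (drop k τ)) lb∧bl))

¬lowerBound-drop : ∀ k τ → k < length τ → All (_< M) τ → ¬ T (lowerBound M (drop k τ))
¬lowerBound-drop {M} zero    (z ∷ τ) _         (z<M ∷ _) h = <⇒≱ z<M (not<ᵇ⇒≥ (proj₁ (T-∧⁻ (not (z <ᵇ M)) h)))
¬lowerBound-drop     (suc k) (z ∷ τ) (s≤s k<n) (_ ∷ τ<M)   = ¬lowerBound-drop k τ k<n τ<M

safeAt-insertAt-before : ∀ p k τ → p < k → k ≤ length τ → All (_< M) τ → ¬ T (safeAt k (insertAt τ p M))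
safeAt-insertAt-before {M} zero (suc k) τ _ k<n τ<M h =
  ¬lowerBound-drop k τ k<n τ<M (proj₁ (T-∧⁻ (lowerBound M (drop k τ)) (proj₂ (T-∧⁻ (nonIncreasing (M ∷ take k τ)) h))))
safeAt-insertAt-before {M} (suc p) (suc k) (y ∷ τ) (s≤s p<k) (s≤s k≤n) (_ ∷ τ<M) h =
  safeAt-insertAt-before p k τ p<k k≤n τ<M (safeAt-tail k y (insertAt τ p M) h)

take-take-++ : ∀ k p (τ l : List ℕ) → k ≤ p → p ≤ length τ → take k (take p τ ++ l) ≡ take k τ
take-take-++ zero    p       τ       l _         _         = refl
take-take-++ (suc k) (suc p) (y ∷ τ) l (s≤s k≤p) (s≤s p≤n) = cong (y ∷_) (take-take-++ k p τ l k≤p p≤n)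

lowerBound-++-∷ : ∀ (l₁ l₂ : List ℕ) → x < M → lowerBound x (l₁ ++ M ∷ l₂) ≡ lowerBound x (l₁ ++ l₂)
lowerBound-++-∷         []       l₂ x<M rewrite <ᵇ-false (<⇒≤ x<M) = refl
lowerBound-++-∷ {x = x} (z ∷ l₁) l₂ x<M = cong (not (z <ᵇ x) ∧_) (lowerBound-++-∷ l₁ l₂ x<M)

lowerBound-drop-insertAt : ∀ k p τ → k ≤ p → p ≤ length τ → x < M →
                           lowerBound x (drop k (insertAt τ p M)) ≡ lowerBound x (drop k τ)
lowerBound-drop-insertAt {x = x} zero p τ _ _ x<M =
  trans (lowerBound-++-∷ (take p τ) (drop p τ) x<M) (cong (lowerBound x) (take++drop≡id p τ))
lowerBound-drop-insertAt (suc k) (suc p) (y ∷ τ) (s≤s k≤p) (s≤s p≤n) x<M =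
  lowerBound-drop-insertAt k p τ k≤p p≤n x<M

below-drop-insertAt : ∀ k p τ l → k ≤ p → p ≤ length τ → All (_< M) l →
                      below l (drop k (insertAt τ p M)) ≡ below l (drop k τ)
below-drop-insertAt k p τ []      _   _   []          = refl
below-drop-insertAt k p τ (x ∷ l) k≤p p≤n (x<M ∷ l<M) =
  cong₂ _∧_ (lowerBound-drop-insertAt k p τ k≤p p≤n x<M) (below-drop-insertAt k p τ l k≤p p≤n l<M)

safeAt-insertAt-after : ∀ k p τ → k ≤ p → p ≤ length τ → All (_< M) τ → safeAt k (insertAt τ p M) ≡ safeAt k τ
safeAt-insertAt-after {M = M} k p τ k≤p p≤n τ<M
  rewrite take-take-++ k p τ (M ∷ drop p τ) k≤p p≤n
        | below-drop-insertAt k p τ (take k τ) k≤p p≤n (All.take⁺ k τ<M) = refl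

safeAt-unique : ∀ k p τ → 1 ≤ k → k < p → p ≤ length τ → Unique τ → T (safeAt p τ) → T (safeAt k τ) → ⊥
safeAt-unique (suc zero) (suc (suc p)) (x ∷ y ∷ τ) _ _ _ ((x≢y ∷ _) ∷ _) hp hk = x≢y (≤-antisym x≤y y≤x)
  where
    x≤y = below⁺ {t₁ = x ∷ []} {t₂ = y ∷ τ} hk (here refl) (here refl)
    y≤x = nonIncreasing-head x (y ∷ take p τ) (proj₁ (T-∧⁻ (nonIncreasing (x ∷ y ∷ take p τ)) hp)) (here refl)
safeAt-unique (suc zero) (suc zero) _ _ (s≤s ()) _ _ _ _
safeAt-unique (suc zero) (suc (suc p)) (x ∷ []) _ _ (s≤s ()) _ _ _
safeAt-unique (suc (suc k)) (suc p) (x ∷ τ) _ (s≤s k<p) (s≤s p≤n) (_ ∷ τ!) hp hk =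
  safeAt-unique (suc k) p τ (s≤s z≤n) k<p p≤n τ! (safeAt-tail p x τ hp) (safeAt-tail (suc k) x τ hk)

nonIncreasing-∷-max : All (_< M) τ → nonIncreasing (M ∷ τ) ≡ nonIncreasing τ
nonIncreasing-∷-max []        = refl
nonIncreasing-∷-max (z<M ∷ _) rewrite <ᵇ-false (<⇒≤ z<M) = refl

safeAt-full-∷ : All (_< M) τ → safeAt (suc (length τ)) (M ∷ τ) ≡ safeAt (length τ) τ
safeAt-full-∷ {τ = τ} τ<M
  rewrite take-all (length τ) τ ≤-refl | drop-all (length τ) τ ≤-refl | nonIncreasing-∷-max τ<M = refl

safeAt-full-insertAt : ∀ p τ → 1 ≤ p → p ≤ length τ → All (_< M) τ →
                       ¬ T (safeAt (suc (length τ)) (insertAt τ p M))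
safeAt-full-insertAt {M} (suc zero) (y ∷ τ) _ _ (y<M ∷ _) h = <⇒≱ y<M (nonIncreasing-head y rest ni (here refl))
  where
    rest = M ∷ take (length τ) τ
    ni = proj₁ (T-∧⁻ (nonIncreasing (y ∷ rest)) h)
safeAt-full-insertAt {M} (suc (suc p)) (y ∷ τ) _ (s≤s p≤n) (_ ∷ τ<M) h =
  safeAt-full-insertAt (suc p) τ (s≤s z≤n) p≤n τ<M (safeAt-tail (suc (length τ)) y (insertAt τ (suc p) M) h)

-- Counting the permutations avoiding 123 and 231

∑ : (A → ℕ) → List A → ℕ
∑ f []       = 0
∑ f (x ∷ xs) = f x + ∑ f xs

syntax ∑ (λ x → e) xs = ∑[ x ∈ xs ] e

∑< : ℕ → (ℕ → ℕ) → ℕ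
∑< zero    f = 0
∑< (suc n) f = f 0 + ∑< n (f ∘ suc)

syntax ∑< n (λ p → e) = ∑[ p < n ] e

indicator : Bool → ℕ
indicator true  = 1
indicator false = 0

indicator≡0 : ∀ {b} → ¬ T b → indicator b ≡ 0
indicator≡0 {false} _  = refl
indicator≡0 {true}  ¬t = ⊥-elim (¬t _)

count≡∑ : ∀ (p : List ℕ → Bool) L → count p L ≡ ∑[ σ ∈ L ] indicator (p σ)
count≡∑ p []      = refl
count≡∑ p (σ ∷ L) with p σ
... | true  = cong suc (count≡∑ p L)
... | false = count≡∑ p L

∑-++ : ∀ (f : A → ℕ) xs ys → ∑ f (xs ++ ys) ≡ ∑ f xs + ∑ f ys
∑-++ f []       ys = refl
∑-++ f (x ∷ xs) ys = trans (cong (f x +_) (∑-++ f xs ys)) (sym (+-assoc (f x) (∑ f xs) (∑ f ys)))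

∑-concatMap : ∀ (f : B → ℕ) (g : A → List B) xs → ∑ f (concatMap g xs) ≡ ∑[ x ∈ xs ] ∑ f (g x)
∑-concatMap f g []       = refl
∑-concatMap f g (x ∷ xs) = trans (∑-++ f (g x) (concatMap g xs)) (cong (∑ f (g x) +_) (∑-concatMap f g xs))

∑-map : ∀ (f : B → ℕ) (g : A → B) xs → ∑ f (map g xs) ≡ ∑ (f ∘ g) xs
∑-map f g []       = refl
∑-map f g (x ∷ xs) = cong (f (g x) +_) (∑-map f g xs)

∑-cong∈ : ∀ {f g : A → ℕ} xs → (∀ {x} → x ∈ xs → f x ≡ g x) → ∑ f xs ≡ ∑ g xs
∑-cong∈ []       _   = refl
∑-cong∈ (x ∷ xs) f≗g = cong₂ _+_ (f≗g (here refl)) (∑-cong∈ xs (f≗g ∘ there))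

∑-+ : ∀ (f g : A → ℕ) xs → ∑[ x ∈ xs ] (f x + g x) ≡ ∑ f xs + ∑ g xs
∑-+ f g []       = refl
∑-+ f g (x ∷ xs) = trans (cong (f x + g x +_) (∑-+ f g xs)) (interchange (f x) (g x) (∑ f xs) (∑ g xs))

∑-zero : ∀ (xs : List A) → ∑[ x ∈ xs ] 0 ≡ 0
∑-zero []       = refl
∑-zero (x ∷ xs) = ∑-zero xs

∑-swap : ∀ (g : A → ℕ → ℕ) n xs → ∑[ x ∈ xs ] ∑[ k < n ] g x k ≡ ∑[ k < n ] ∑[ x ∈ xs ] g x k
∑-swap g zero    xs = ∑-zero xs
∑-swap g (suc n) xs = trans (∑-+ (λ x → g x 0) (λ x → ∑[ k < n ] g x (suc k)) xs)
                            (cong (∑[ x ∈ xs ] g x 0 +_) (∑-swap (λ x → g x ∘ suc) n xs))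

∑<-cong : ∀ n {f g : ℕ → ℕ} → (∀ {p} → p < n → f p ≡ g p) → ∑< n f ≡ ∑< n g
∑<-cong zero    _   = refl
∑<-cong (suc n) f≗g = cong₂ _+_ (f≗g (s≤s z≤n)) (∑<-cong n (f≗g ∘ s≤s))

∑<-zero : ∀ n {f : ℕ → ℕ} → (∀ {p} → p < n → f p ≡ 0) → ∑< n f ≡ 0
∑<-zero zero    _  = refl
∑<-zero (suc n) f0 rewrite f0 (s≤s z≤n) = ∑<-zero n (f0 ∘ s≤s)

∑<-single : ∀ n {f : ℕ → ℕ} {k} → k < n → (∀ {p} → p < n → p ≢ k → f p ≡ 0) → ∑< n f ≡ f k
∑<-single (suc n) {f} {zero}  _         f0 =
  trans (cong (f 0 +_) (∑<-zero n (λ p<n → f0 (s≤s p<n) λ ()))) (+-identityʳ (f 0))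
∑<-single (suc n) {f} {suc k} (s≤s k<n) f0 rewrite f0 (s≤s z≤n) (λ ()) =
  ∑<-single n k<n (λ p<n p≢k → f0 (s≤s p<n) (p≢k ∘ suc-injective))

∑<-one : ∀ n → ∑[ p < n ] 1 ≡ n
∑<-one zero    = refl
∑<-one (suc n) = cong suc (∑<-one n)

∑-inserts : ∀ (f : List ℕ → ℕ) x τ → ∑ f (inserts x τ) ≡ ∑[ p < suc (length τ) ] f (insertAt τ p x)
∑-inserts f x []      = refl
∑-inserts f x (y ∷ τ) =
  cong (f (x ∷ y ∷ τ) +_) (trans (∑-map f (y ∷_) (inserts x τ)) (∑-inserts (f ∘ (y ∷_)) x τ))

∑-inserts-avoids : length τ ≡ m → All (_< m) τ →
  ∑[ σ ∈ inserts m τ ] indicator (avoids123-231 σ) ≡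
  indicator (avoids123-231 τ) + ∑[ k < m ] indicator (avoids123-231 τ ∧ safeAt (suc k) τ)
∑-inserts-avoids {τ = τ} refl τ<ℓ = begin
  ∑[ σ ∈ inserts ℓ τ ] indicator (avoids123-231 σ)
    ≡⟨ ∑-inserts (indicator ∘ avoids123-231) ℓ τ ⟩
  ∑[ p < suc ℓ ] indicator (avoids123-231 (insertAt τ p ℓ))
    ≡⟨ ∑<-cong (suc ℓ) (λ {p} _ → cong indicator (avoids-insertAt {p = p} τ<ℓ)) ⟩
  indicator (avoids123-231 τ ∧ true) + rest
    ≡⟨ cong (λ b → indicator b + rest) (∧-identityʳ (avoids123-231 τ)) ⟩
  indicator (avoids123-231 τ) + rest ∎
  where
    open ≡-Reasoning
    ℓ = length τ
    rest = ∑[ k < ℓ ] indicator (avoids123-231 τ ∧ safeAt (suc k) τ)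

∑-inserts-safe : length τ ≡ m → All (_< m) τ → Unique τ → 1 ≤ k → k ≤ m →
  ∑[ σ ∈ inserts m τ ] indicator (avoids123-231 σ ∧ safeAt k σ) ≡ indicator (avoids123-231 τ ∧ safeAt k τ)
∑-inserts-safe {τ = τ} {k = k} refl τ<ℓ τ! 1≤k k≤ℓ =
  trans (∑-inserts _ ℓ τ) (trans (∑<-single (suc ℓ) (s≤s k≤ℓ) vanish) (cong indicator at-k))
  where
    ℓ = length τ
    at-k : avoids123-231 (insertAt τ k ℓ) ∧ safeAt k (insertAt τ k ℓ) ≡ avoids123-231 τ ∧ safeAt k τ
    at-k rewrite avoids-insertAt {p = k} τ<ℓ | safeAt-insertAt-after k k τ ≤-refl k≤ℓ τ<ℓ =
      trans (∧-assoc (avoids123-231 τ) _ _) (cong (avoids123-231 τ ∧_) (∧-idem (safeAt k τ)))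
    vanish : ∀ {p} → p < suc ℓ → p ≢ k →
             indicator (avoids123-231 (insertAt τ p ℓ) ∧ safeAt k (insertAt τ p ℓ)) ≡ 0
    vanish {p} (s≤s p≤ℓ) p≢k with <-cmp p k
    ... | tri< p<k _ _ =
      indicator≡0 (safeAt-insertAt-before p k τ p<k k≤ℓ τ<ℓ ∘ proj₂ ∘ T-∧⁻ (avoids123-231 (insertAt τ p ℓ)))
    ... | tri≈ _ p≡k _ = ⊥-elim (p≢k p≡k)
    ... | tri> _ _ k<p rewrite avoids-insertAt {p = p} τ<ℓ | safeAt-insertAt-after k p τ (<⇒≤ k<p) p≤ℓ τ<ℓ =
      indicator≡0 λ h → let av∧sp , sk = T-∧⁻ (avoids123-231 τ ∧ safeAt p τ) h in
        safeAt-unique k p τ 1≤k k<p p≤ℓ τ! (proj₂ (T-∧⁻ (avoids123-231 τ) av∧sp)) sk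

∑-inserts-safe-top : length τ ≡ m → All (_< m) τ →
  ∑[ σ ∈ inserts m τ ] indicator (avoids123-231 σ ∧ safeAt (suc m) σ) ≡ indicator (avoids123-231 τ ∧ safeAt m τ)
∑-inserts-safe-top {τ = τ} refl τ<ℓ =
  trans (∑-inserts _ ℓ τ) (trans (∑<-single (suc ℓ) (s≤s z≤n) vanish) (cong indicator at-0))
  where
    ℓ = length τ
    at-0 : avoids123-231 (ℓ ∷ τ) ∧ safeAt (suc ℓ) (ℓ ∷ τ) ≡ avoids123-231 τ ∧ safeAt ℓ τ
    at-0 rewrite avoids-insertAt {p = 0} τ<ℓ | safeAt-full-∷ τ<ℓ =
      cong (_∧ safeAt ℓ τ) (∧-identityʳ (avoids123-231 τ))
    vanish : ∀ {p} → p < suc ℓ → p ≢ 0 →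
             indicator (avoids123-231 (insertAt τ p ℓ) ∧ safeAt (suc ℓ) (insertAt τ p ℓ)) ≡ 0
    vanish {zero}  _         0≢0 = ⊥-elim (0≢0 refl)
    vanish {suc p} (s≤s p<ℓ) _   = indicator≡0
      (safeAt-full-insertAt (suc p) τ (s≤s z≤n) p<ℓ τ<ℓ ∘ proj₂ ∘ T-∧⁻ (avoids123-231 (insertAt τ (suc p) ℓ)))

avoiders : ℕ → ℕ
avoiders m = ∑[ τ ∈ perms m ] indicator (avoids123-231 τ)

safeAvoiders : ℕ → ℕ → ℕ
safeAvoiders m k = ∑[ τ ∈ perms m ] indicator (avoids123-231 τ ∧ safeAt k τ)

avoiders-suc : ∀ m → avoiders (suc m) ≡ avoiders m + ∑[ k < m ] safeAvoiders m (suc k)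
avoiders-suc m = begin
  avoiders (suc m)
    ≡⟨ ∑-concatMap (indicator ∘ avoids123-231) (inserts m) (perms m) ⟩
  ∑[ τ ∈ perms m ] ∑[ σ ∈ inserts m τ ] indicator (avoids123-231 σ)
    ≡⟨ ∑-cong∈ (perms m) (λ τ∈ → ∑-inserts-avoids (perms-length m τ∈) (perms-bounded m τ∈)) ⟩
  ∑[ τ ∈ perms m ] (indicator (avoids123-231 τ) + ∑[ k < m ] safeIndicator τ k)
    ≡⟨ ∑-+ _ _ (perms m) ⟩
  avoiders m + ∑[ τ ∈ perms m ] ∑[ k < m ] safeIndicator τ k
    ≡⟨ cong (avoiders m +_) (∑-swap safeIndicator m (perms m)) ⟩
  avoiders m + ∑[ k < m ] safeAvoiders m (suc k) ∎
  where
    open ≡-Reasoning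
    safeIndicator : List ℕ → ℕ → ℕ
    safeIndicator τ k = indicator (avoids123-231 τ ∧ safeAt (suc k) τ)

safeAvoiders-suc : 1 ≤ k → k ≤ m → safeAvoiders (suc m) k ≡ safeAvoiders m k
safeAvoiders-suc {k} {m} 1≤k k≤m = trans (∑-concatMap _ (inserts m) (perms m)) (∑-cong∈ (perms m)
  λ τ∈ → ∑-inserts-safe (perms-length m τ∈) (perms-bounded m τ∈) (perms-Unique m τ∈) 1≤k k≤m)

safeAvoiders-top : ∀ m → safeAvoiders (suc m) (suc m) ≡ safeAvoiders m m
safeAvoiders-top m = trans (∑-concatMap _ (inserts m) (perms m)) (∑-cong∈ (perms m)
  λ τ∈ → ∑-inserts-safe-top (perms-length m τ∈) (perms-bounded m τ∈))

-- The permutation counted is k-1 ⋯ 1 0 followed by m-1 ⋯ k+1 k.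

safeAvoiders≡1 : ∀ m k → 1 ≤ k → k ≤ m → safeAvoiders m k ≡ 1
safeAvoiders≡1 zero    (suc k) _   ()
safeAvoiders≡1 (suc m) k       1≤k k≤1+m with k ≤? m
... | yes k≤m = trans (safeAvoiders-suc 1≤k k≤m) (safeAvoiders≡1 m k 1≤k k≤m)
... | no  k≰m with ≤-antisym k≤1+m (≰⇒> k≰m)
...   | refl with m
...     | zero   = refl
...     | suc m′ = trans (safeAvoiders-top (suc m′)) (safeAvoiders≡1 (suc m′) (suc m′) (s≤s z≤n) ≤-refl)

avoiders≡1+C2 : ∀ m → avoiders m ≡ 1 + m C 2
avoiders≡1+C2 zero    = refl
avoiders≡1+C2 (suc m) = begin
  avoiders (suc m)                               ≡⟨ avoiders-suc m ⟩
  avoiders m + ∑[ k < m ] safeAvoiders m (suc k) ≡⟨ cong₂ _+_ (avoiders≡1+C2 m) (trans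
                                                      (∑<-cong m (λ k<m → safeAvoiders≡1 m _ (s≤s z≤n) k<m))
                                                      (∑<-one m)) ⟩
  1 + m C 2 + m                                  ≡⟨ cong suc (+-comm (m C 2) m) ⟩
  1 + (m + m C 2)                                ≡⟨ cong (λ x → 1 + (x + m C 2)) (sym (nC1≡n m)) ⟩
  1 + (m C 1 + m C 2)                            ≡⟨ cong suc (nCk+nC[k+1]≡[n+1]C[k+1] m 1) ⟩
  1 + suc m C 2                                  ∎
  where open ≡-Reasoning

numAv-1234-1423 : ∀ m → numAv (suc m) (π1234 ∷ π1423 ∷ []) ≡ count avoids123-231 (perms m)
numAv-1234-1423 m = trans (numAv-suc m (π1234 ∷ π1423 ∷ []))
  (count-cong∈ _ avoids123-231 (perms m) (cycAvoids1234-1423≡avoids123-231 ∘ perms-bounded m))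

numAv-1324-1432 : ∀ m → numAv (suc m) (π1324 ∷ π1432 ∷ []) ≡ count (avoids123-231 ∘ reverse) (perms m)
numAv-1324-1432 m = trans (numAv-suc m (π1324 ∷ π1432 ∷ []))
  (count-cong∈ _ (avoids123-231 ∘ reverse) (perms m) λ {τ} τ∈ →
    trans (cycAvoids1324-1432≡avoids132-321 (perms-bounded m τ∈)) (avoids132-321≡avoids123-231∘reverse τ))

mainTheorem4 : ((n : ℕ) → numAv n ((1 ∷ 2 ∷ 3 ∷ 4 ∷ []) ∷ (1 ∷ 4 ∷ 2 ∷ 3 ∷ []) ∷ []) ≡ numAv n ((1 ∷ 3 ∷ 2 ∷ 4 ∷ []) ∷ (1 ∷ 4 ∷ 3 ∷ 2 ∷ []) ∷ []))
    × ((n : ℕ) → 1 ≤ n → numAv n ((1 ∷ 2 ∷ 3 ∷ 4 ∷ []) ∷ (1 ∷ 4 ∷ 2 ∷ 3 ∷ []) ∷ []) ≡ 1 + ((n ∸ 1) C 2))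
mainTheorem4 = equinumerous , formula
  where
    equinumerous : ∀ n → numAv n (π1234 ∷ π1423 ∷ []) ≡ numAv n (π1324 ∷ π1432 ∷ [])
    equinumerous zero    = refl
    equinumerous (suc m) =
      trans (numAv-1234-1423 m) (trans (sym (count-reverse avoids123-231 m)) (sym (numAv-1324-1432 m)))
    formula : ∀ n → 1 ≤ n → numAv n (π1234 ∷ π1423 ∷ []) ≡ 1 + (n ∸ 1) C 2
    formula (suc m) _ = trans (numAv-1234-1423 m) (trans (count≡∑ avoids123-231 (perms m)) (avoiders≡1+C2 m))
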